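{- Let $p$ be a prime greater than $2$, $m$ a positive integer, and $f \colon GF(p)^{2m} \to GF(p)$ an even function with $f(0)=0$. If the component Cayley graphs of $f$ are all strongly regular and are either all of feasible Latin square type or all of feasible negative Latin square type, then $f$ is bent.
   Context: Let $\zeta = e^{2\pi i/p}$, identify $GF(p)$ with $\{0,\dots,p-1\}$. The Walsh transform of $f$ is $W_f(x) = \sum_y \zeta^{f(y) - \langle x,y\rangle}$ ($\langle\ ,\ \rangle$ the standard inner product); $f$ is bent if $|W_f(x)| = p^m$ for all $x \in GF(p)^{2m}$. Level sets: $D_i = f^{ -1}(i)$ for $1 \le i \le p-1$, $D_p = f^{ -1}(0)\setminus\{0\}$. The component Cayley graph $\Gamma_i$ ($1 \le i \le p$) has vertex set $GF(p)^{2m}$, with distinct $x,y$ adjacent iff $x-y \in D_i$. A strongly regular graph with parameters $(\nu,k,\lambda,\mu)$ is a $k$-regular graph on $\nu$ vertices in which adjacent vertices have $\lambda$ common neighbors and distinct nonadjacent vertices have $\mu$ common neighbors. The graphs are all of feasible Latin square type (resp. feasible negative Latin square type) if each $\Gamma_i$ is strongly regular with parameters $(N^2, (N-1)r_i, N + r_i^2 - 3r_i, r_i^2 - r_i)$, where $N = p^m$ (resp. $N = -p^m$), $r_i = N/p$ for $1 \le i \le p-1$, and $r_p = N/p + 1$. -}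

module Defs where

open import Data.Nat as ℕ using (ℕ; zero; suc; NonZero; _∸_; _^_)
open import Data.Nat.DivMod using (_mod_)
open import Data.Fin using (Fin; toℕ)
open import Data.Fin.Properties as FinP using ()
open import Data.Vec as Vec using (Vec; []; _∷_; zipWith; replicate)
open import Data.Vec.Properties as VecP using ()
open import Data.List as List using (List; []; _∷_; concatMap; allFin; filter; length)
open import Data.Integer as ℤ using (ℤ; +_; -_)
open import Data.Bool using (if_then_else_)
open import Data.Product using (_×_; ∃)
open import Relation.Binary.PropositionalEquality using (_≡_; _≢_)
open import Relation.Nullary using (¬_)
open import Relation.Nullary.Decidable using (⌊_⌋; _×-dec_; ¬?)
open import Relation.Binary using (Decidable)

module GF (p : ℕ) .{{nz : NonZero p}} where

  F : Set
  F = Fin p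

  0F : F
  0F = 0 mod p

  _⊕_ : F → F → F
  a ⊕ b = (toℕ a ℕ.+ toℕ b) mod p

  ⊖_ : F → F
  ⊖ a = (p ∸ toℕ a) mod p

  _⊖_ : F → F → F
  a ⊖ b = a ⊕ (⊖ b)

  V : ℕ → Set
  V n = Vec F n

  0ᵥ : ∀ {n} → V n
  0ᵥ = replicate _ 0F

  -ᵥ_ : ∀ {n} → V n → V n
  -ᵥ x = Vec.map ⊖_ x

  _-ᵥ_ : ∀ {n} → V n → V n → V n
  x -ᵥ y = zipWith _⊖_ x y

  ⟨_,_⟩ : ∀ {n} → V n → V n → F
  ⟨ x , y ⟩ = Vec.sum (zipWith (λ a b → toℕ a ℕ.* toℕ b) x y) mod p

  allVecs : (n : ℕ) → List (V n)
  allVecs zero = [] ∷ []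
  allVecs (suc n) = concatMap (λ a → List.map (a ∷_) (allVecs n)) (allFin p)

  _≟ᵥ_ : ∀ {n} → Decidable {A = V n} _≡_
  _≟ᵥ_ = VecP.≡-dec FinP._≟_

  -- The cyclotomic integers ℤ[ζ], ζ = e^{2πi/p}.
  -- An element is a coefficient function c, standing for Σ_j c(j) ζ^j.
  -- Since 1 + ζ + … + ζ^{p-1} = 0 is the only relation (ℤ[x]/(x^p - 1)
  -- modulo the ideal generated by Φ_p, which in the group ring is ℤ·(1+x+…+x^{p-1})),
  -- two coefficient functions denote the same complex number iff their
  -- difference is a constant function.
  Cyc : Set
  Cyc = F → ℤ

  _≈ᶜ_ : Cyc → Cyc → Set
  a ≈ᶜ b = ∃ λ (t : ℤ) → ∀ j → a j ℤ.- b j ≡ t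

  ζ^ : F → Cyc
  ζ^ a j = if ⌊ j FinP.≟ a ⌋ then + 1 else + 0

  constᶜ : ℤ → Cyc
  constᶜ z j = if ⌊ j FinP.≟ 0F ⌋ then z else + 0

  _+ᶜ_ : Cyc → Cyc → Cyc
  (a +ᶜ b) j = a j ℤ.+ b j

  0ᶜ : Cyc
  0ᶜ _ = + 0

  Σℤ : ∀ {A : Set} → List A → (A → ℤ) → ℤ
  Σℤ xs g = List.foldr (λ x acc → g x ℤ.+ acc) (+ 0) xs

  Σᶜ : ∀ {A : Set} → List A → (A → Cyc) → Cyc
  Σᶜ xs g = List.foldr (λ x acc → g x +ᶜ acc) 0ᶜ xs

  -- product: ζ^i ζ^j = ζ^{i+j}
  _*ᶜ_ : Cyc → Cyc → Cyc
  (a *ᶜ b) k = Σℤ (allFin p) (λ i → a i ℤ.* b (k ⊖ i))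

  -- complex conjugation: conj(ζ^j) = ζ^{-j}
  conj : Cyc → Cyc
  conj a j = a (⊖ j)

  Walsh : ∀ {n} → (V n → F) → V n → Cyc
  Walsh {n} f x = Σᶜ (allVecs n) (λ y → ζ^ (f y ⊖ ⟨ x , y ⟩))

  -- f : GF(p)^{2m} → GF(p) is bent iff |W_f(x)| = p^m for all x,
  -- i.e. (|W_f(x)| ≥ 0) iff W_f(x) · conj(W_f(x)) = (p^m)² in ℤ[ζ].
  Bent : (m : ℕ) → (V (2 ℕ.* m) → F) → Set
  Bent m f = ∀ x → (Walsh f x *ᶜ conj (Walsh f x)) ≈ᶜ constᶜ (+ ((p ^ m) ℕ.* (p ^ m)))

  Even : ∀ {n} → (V n → F) → Set
  Even f = ∀ x → f (-ᵥ x) ≡ f x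

  -- Component Cayley graphs Γ_i, 1 ≤ i ≤ p:
  -- distinct x, y adjacent iff x - y ∈ D_i, where D_i = f⁻¹(i) (i < p)
  -- and D_p = f⁻¹(0) ∖ {0}.  Since x ≠ y forces x - y ≠ 0, this is
  -- x ≠ y ∧ f(x - y) = i mod p.
  Adj : ∀ {n} → (V n → F) → ℕ → V n → V n → Set
  Adj f i x y = x ≢ y × f (x -ᵥ y) ≡ i mod p

  adj? : ∀ {n} (f : V n → F) (i : ℕ) → Decidable (Adj f i)
  adj? f i x y = ¬? (x ≟ᵥ y) ×-dec (f (x -ᵥ y) FinP.≟ (i mod p))

  module _ {n : ℕ} (E : V n → V n → Set) (E? : Decidable E) where
    degree : V n → ℕ
    degree x = length (filter (λ y → E? x y) (allVecs n))

    common : V n → V n → ℕ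
    common x y = length (filter (λ z → E? x z ×-dec E? y z) (allVecs n))

    StronglyRegular : ℤ → ℤ → ℤ → ℤ → Set
    StronglyRegular ν k λ' μ =
        (+ length (allVecs n) ≡ ν)
      × (∀ x → + degree x ≡ k)
      × (∀ x y → E x y → + common x y ≡ λ')
      × (∀ x y → x ≢ y → ¬ E x y → + common x y ≡ μ)

  -- feasible (negative) Latin square parameters: s = +1 gives N = p^m
  -- (Latin square type), s = -1 gives N = -p^m (negative Latin square type).
  -- N/p = s·p^{m-1} (exact since m ≥ 1); r_i = N/p for i < p, r_p = N/p + 1.
  module LS (s : ℤ) (m : ℕ) (i : ℕ) where
    N : ℤ
    N = s ℤ.* + (p ^ m)

    r : ℤ
    r = if ⌊ i ℕ.≟ p ⌋ then s ℤ.* + (p ^ (m ∸ 1)) ℤ.+ + 1 else s ℤ.* + (p ^ (m ∸ 1))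

  AllOfLSType : (s : ℤ) (m : ℕ) → (V (2 ℕ.* m) → F) → Set
  LSParams : (s : ℤ) (m i : ℕ) → (V (2 ℕ.* m) → F) → Set
  LSParams s m i f =
    StronglyRegular (Adj f i) (adj? f i)
      (N ℤ.* N) ((N ℤ.- + 1) ℤ.* r) (N ℤ.+ r ℤ.* r ℤ.- + 3 ℤ.* r) (r ℤ.* r ℤ.- r)
    where open LS s m i

  AllOfLSType s m f = ∀ i → 1 ℕ.≤ i → i ℕ.≤ p → LSParams s m i f

-- Fix x and let Y_c = χ_c + r_c, where χ_c = Σ_{u ∈ D_c} ζ^⟨x,u⟩ is the character sum of a level set.
-- For x = 0, χ_c is just |D_c| = (N - 1) r_c, and W_f(0) = N directly.  For x ≠ 0 the full character
-- sum Σ_u ζ^⟨x,u⟩ vanishes, so the strongly regular parameters give Y_c² = N Y_c, and Σ_c Y_c = N;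
-- evenness of f makes each Y_c real.  The Y_c / N are then idempotents summing to 1, and positivity of
-- the trace form Tr (a · ā) forces Y_c Y_d = 0 for c ≠ d.  Since W_f(x) = Σ_c ζ^c Y_c in ℤ[ζ],
-- |W_f(x)|² = Σ_c Y_c² = N Σ_c Y_c = N².

module Submission where

open import Defs
open import Data.Bool using (if_then_else_)
open import Data.Fin using (Fin; toℕ)
import Data.Fin.Properties as FinP
open import Data.Integer as ℤ using (ℤ; +_; -_; _+_; _*_; _-_; _≤_; +≤+; ∣_∣)
import Data.Integer.Properties as ℤP
open import Data.Integer.Divisibility.Signed as ℤDiv using (divides)
open import Data.Integer.Tactic.RingSolver using (solve-∀)
open import Data.List as List using (List; []; _∷_; _++_; concatMap; filter; length; allFin; tabulate)
import Data.List.Properties as ListP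
open import Data.List.Membership.Propositional using (_∈_)
open import Data.List.Membership.Propositional.Properties using (∈-allFin)
open import Data.List.Relation.Unary.Any using (here; there)
open import Data.Nat as ℕ using (ℕ; zero; suc; NonZero; _^_)
import Data.Nat.Properties as ℕP
open import Data.Nat.DivMod using (_mod_; _%_; _/_; m%n<n; m≡m%n+[m/n]*n)
import Data.Nat.Divisibility as ℕDiv
open import Data.Nat.Coprimality using (Coprime; coprime-Bézout)
open import Data.Nat.GCD using (module Bézout)
open import Data.Nat.Primality using (Prime; prime⇒irreducible)
open import Data.Empty using (⊥-elim)
open import Data.Product using (_×_; _,_; proj₁; proj₂; ∃)
open import Data.Sum using (_⊎_; inj₁; inj₂)
open import Data.Vec as Vec using (Vec; []; _∷_)
open import Function using (_∘_; id)
open import Relation.Binary using (DecidableEquality; Setoid)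
import Relation.Binary.Reasoning.Setoid as SetoidReasoning
open import Relation.Binary.PropositionalEquality
open import Relation.Nullary using (Dec; yes; no; does; ¬_; contradiction)
open import Relation.Nullary.Decidable using (_×-dec_; ¬?; isYes≗does; dec-true; dec-false)
open import Relation.Unary using (Pred; Decidable)

+-nonneg-≡0ˡ : ∀ {a b} → + 0 ≤ a → + 0 ≤ b → a + b ≡ + 0 → a ≡ + 0
+-nonneg-≡0ˡ {+ n} {+ m} _ _ e = cong +_ (ℕP.m+n≡0⇒m≡0 n (ℤP.+-injective e))

+-nonneg-≡0ʳ : ∀ {a b} → + 0 ≤ a → + 0 ≤ b → a + b ≡ + 0 → b ≡ + 0
+-nonneg-≡0ʳ {a} {b} a≥0 b≥0 e = +-nonneg-≡0ˡ b≥0 a≥0 (trans (ℤP.+-comm b a) e)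

square-nonneg : ∀ i → + 0 ≤ i * i
square-nonneg (+ n)       = subst (+ 0 ≤_) (ℤP.pos-* n n) (+≤+ ℕ.z≤n)
square-nonneg ℤ.-[1+ n ] = +≤+ ℕ.z≤n

square≡0⇒≡0 : ∀ i → i * i ≡ + 0 → i ≡ + 0
square≡0⇒≡0 (+ zero)    _ = refl
square≡0⇒≡0 (+ suc n)   ()
square≡0⇒≡0 ℤ.-[1+ n ] ()

*-nonneg⇒nonneg : ∀ q .{{_ : NonZero q}} x → + 0 ≤ + q * x → + 0 ≤ x
*-nonneg⇒nonneg (suc q) (+ n)       _  = +≤+ ℕ.z≤n
*-nonneg⇒nonneg (suc q) ℤ.-[1+ n ] ()

-- The same sum as GF.Σℤ of Defs, which is hidden below only because it is parametrised by p.
Σℤ : ∀ {A : Set} → List A → (A → ℤ) → ℤ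
Σℤ xs g = List.foldr (λ x acc → g x + acc) (+ 0) xs

module _ {A : Set} where

  Σℤ-cong : ∀ (xs : List A) {g h : A → ℤ} → (∀ x → g x ≡ h x) → Σℤ xs g ≡ Σℤ xs h
  Σℤ-cong []       e = refl
  Σℤ-cong (x ∷ xs) e = cong₂ _+_ (e x) (Σℤ-cong xs e)

  Σℤ-distrib-+ : ∀ (xs : List A) (g h : A → ℤ) → Σℤ xs (λ x → g x + h x) ≡ Σℤ xs g + Σℤ xs h
  Σℤ-distrib-+ []       g h = refl
  Σℤ-distrib-+ (x ∷ xs) g h rewrite Σℤ-distrib-+ xs g h = shuffle (g x) (h x) (Σℤ xs g) (Σℤ xs h)
    where shuffle : ∀ a b c d → a + b + (c + d) ≡ a + c + (b + d)
          shuffle = solve-∀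

  Σℤ-*ˡ : ∀ (xs : List A) (c : ℤ) (g : A → ℤ) → Σℤ xs (λ x → c * g x) ≡ c * Σℤ xs g
  Σℤ-*ˡ []       c g = sym (ℤP.*-zeroʳ c)
  Σℤ-*ˡ (x ∷ xs) c g rewrite Σℤ-*ˡ xs c g = sym (ℤP.*-distribˡ-+ c (g x) (Σℤ xs g))

  Σℤ-*ʳ : ∀ (xs : List A) (c : ℤ) (g : A → ℤ) → Σℤ xs (λ x → g x * c) ≡ Σℤ xs g * c
  Σℤ-*ʳ xs c g = begin
    Σℤ xs (λ x → g x * c) ≡⟨ Σℤ-cong xs (λ x → ℤP.*-comm (g x) c) ⟩
    Σℤ xs (λ x → c * g x) ≡⟨ Σℤ-*ˡ xs c g ⟩
    c * Σℤ xs g           ≡⟨ ℤP.*-comm c _ ⟩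
    Σℤ xs g * c           ∎
    where open ≡-Reasoning

  Σℤ-linear₃ : ∀ (xs : List A) (α β γ : ℤ) (g h k : A → ℤ) →
    Σℤ xs (λ x → α * g x + β * h x + γ * k x) ≡ α * Σℤ xs g + β * Σℤ xs h + γ * Σℤ xs k
  Σℤ-linear₃ xs α β γ g h k = begin
    Σℤ xs (λ x → α * g x + β * h x + γ * k x)
      ≡⟨ Σℤ-distrib-+ xs (λ x → α * g x + β * h x) (λ x → γ * k x) ⟩
    Σℤ xs (λ x → α * g x + β * h x) + Σℤ xs (λ x → γ * k x)
      ≡⟨ cong₂ _+_ (Σℤ-distrib-+ xs (λ x → α * g x) (λ x → β * h x)) (Σℤ-*ˡ xs γ k) ⟩
    Σℤ xs (λ x → α * g x) + Σℤ xs (λ x → β * h x) + γ * Σℤ xs k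
      ≡⟨ cong₂ (λ u v → u + v + γ * Σℤ xs k) (Σℤ-*ˡ xs α g) (Σℤ-*ˡ xs β h) ⟩
    α * Σℤ xs g + β * Σℤ xs h + γ * Σℤ xs k ∎
    where open ≡-Reasoning

  Σℤ-zero : ∀ (xs : List A) → Σℤ xs (λ _ → + 0) ≡ + 0
  Σℤ-zero []       = refl
  Σℤ-zero (x ∷ xs) = trans (ℤP.+-identityˡ _) (Σℤ-zero xs)

  Σℤ-const : ∀ (xs : List A) (c : ℤ) → Σℤ xs (λ _ → c) ≡ + length xs * c
  Σℤ-const []       c = sym (ℤP.*-zeroˡ c)
  Σℤ-const (x ∷ xs) c rewrite Σℤ-const xs c = ring c (+ length xs)
    where ring : ∀ c n → c + n * c ≡ (+ 1 + n) * c
          ring = solve-∀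

  Σℤ-++ : ∀ (xs ys : List A) (g : A → ℤ) → Σℤ (xs ++ ys) g ≡ Σℤ xs g + Σℤ ys g
  Σℤ-++ []       ys g = sym (ℤP.+-identityˡ _)
  Σℤ-++ (x ∷ xs) ys g rewrite Σℤ-++ xs ys g = sym (ℤP.+-assoc (g x) _ _)

  Σℤ-nonneg : ∀ (xs : List A) (g : A → ℤ) → (∀ x → + 0 ≤ g x) → + 0 ≤ Σℤ xs g
  Σℤ-nonneg []       g g≥0 = +≤+ ℕ.z≤n
  Σℤ-nonneg (x ∷ xs) g g≥0 = ℤP.+-mono-≤ (g≥0 x) (Σℤ-nonneg xs g g≥0)

  Σℤ-nonneg-≡0 : ∀ (xs : List A) (g : A → ℤ) → (∀ x → + 0 ≤ g x) →
                 Σℤ xs g ≡ + 0 → ∀ {x} → x ∈ xs → g x ≡ + 0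
  Σℤ-nonneg-≡0 (y ∷ xs) g g≥0 Σ≡0 (here refl) = +-nonneg-≡0ˡ (g≥0 y) (Σℤ-nonneg xs g g≥0) Σ≡0
  Σℤ-nonneg-≡0 (y ∷ xs) g g≥0 Σ≡0 (there x∈xs) =
    Σℤ-nonneg-≡0 xs g g≥0 (+-nonneg-≡0ʳ (g≥0 y) (Σℤ-nonneg xs g g≥0) Σ≡0) x∈xs

module _ {A B : Set} where

  Σℤ-map : ∀ (f : A → B) (xs : List A) (g : B → ℤ) → Σℤ (List.map f xs) g ≡ Σℤ xs (g ∘ f)
  Σℤ-map f []       g = refl
  Σℤ-map f (x ∷ xs) g = cong (_+_ (g (f x))) (Σℤ-map f xs g)

  Σℤ-concatMap : ∀ (f : A → List B) (xs : List A) (g : B → ℤ) →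
                 Σℤ (concatMap f xs) g ≡ Σℤ xs (λ x → Σℤ (f x) g)
  Σℤ-concatMap f []       g = refl
  Σℤ-concatMap f (x ∷ xs) g =
    trans (Σℤ-++ (f x) (concatMap f xs) g) (cong (_+_ (Σℤ (f x) g)) (Σℤ-concatMap f xs g))

  Σℤ-swap : ∀ (xs : List A) (ys : List B) (g : A → B → ℤ) →
            Σℤ xs (λ x → Σℤ ys (g x)) ≡ Σℤ ys (λ y → Σℤ xs (λ x → g x y))
  Σℤ-swap []       ys g = sym (Σℤ-zero ys)
  Σℤ-swap (x ∷ xs) ys g = trans (cong (_+_ (Σℤ ys (g x))) (Σℤ-swap xs ys g))
                                (sym (Σℤ-distrib-+ ys (g x) (λ y → Σℤ xs (λ x′ → g x′ y))))

𝟙 : ∀ {P : Set} → Dec P → ℤ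
𝟙 d = if does d then + 1 else + 0

𝟙-yes : ∀ {P : Set} (d : Dec P) → P → 𝟙 d ≡ + 1
𝟙-yes (yes _) _ = refl
𝟙-yes (no ¬p) p = ⊥-elim (¬p p)

𝟙-no : ∀ {P : Set} (d : Dec P) → ¬ P → 𝟙 d ≡ + 0
𝟙-no (yes p) ¬p = ⊥-elim (¬p p)
𝟙-no (no _)  _  = refl

𝟙-cong : ∀ {P Q : Set} (P? : Dec P) (Q? : Dec Q) → (P → Q) → (Q → P) → 𝟙 P? ≡ 𝟙 Q?
𝟙-cong (yes p) Q? P→Q Q→P = sym (𝟙-yes Q? (P→Q p))
𝟙-cong (no ¬p) Q? P→Q Q→P = sym (𝟙-no Q? (¬p ∘ Q→P))

𝟙-× : ∀ {P Q R : Set} (P? : Dec P) (Q? : Dec Q) (R? : Dec R) →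
      (R → P) → (R → Q) → (P → Q → R) → 𝟙 R? ≡ 𝟙 P? * 𝟙 Q?
𝟙-× (yes p) (yes q) R? _   _   mk = 𝟙-yes R? (mk p q)
𝟙-× (yes p) (no ¬q) R? _   R→Q _  = 𝟙-no R? (¬q ∘ R→Q)
𝟙-× (no ¬p) Q?      R? R→P _   _  = 𝟙-no R? (¬p ∘ R→P)

𝟙-¬ : ∀ {P : Set} (P? : Dec P) → 𝟙 (¬? P?) ≡ + 1 - 𝟙 P?
𝟙-¬ (yes _) = refl
𝟙-¬ (no _)  = refl

length-filter≡Σ𝟙 : ∀ {A : Set} {P : Pred A _} (P? : Decidable P) (xs : List A) →
                   + length (filter P? xs) ≡ Σℤ xs (λ x → 𝟙 (P? x))
length-filter≡Σ𝟙 P? [] = refl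
length-filter≡Σ𝟙 P? (x ∷ xs) with P? x
... | yes _ = cong (_+_ (+ 1)) (length-filter≡Σ𝟙 P? xs)
... | no _  = trans (length-filter≡Σ𝟙 P? xs) (sym (ℤP.+-identityˡ _))

module Enumeration {A : Set} (_≟_ : DecidableEquality A) where

  δ : A → A → ℤ
  δ x y = 𝟙 (x ≟ y)

  δ-sym : ∀ x y → δ x y ≡ δ y x
  δ-sym x y = 𝟙-cong (x ≟ y) (y ≟ x) sym sym

  δ-refl : ∀ x → δ x x ≡ + 1
  δ-refl x = 𝟙-yes (x ≟ x) refl

  IsEnumeration : List A → Set
  IsEnumeration xs = ∀ w → Σℤ xs (λ y → δ y w) ≡ + 1

  module Sums (xs : List A) (enum : IsEnumeration xs) where

    Σ-δ : ∀ w (g : A → ℤ) → Σℤ xs (λ y → δ y w * g y) ≡ g w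
    Σ-δ w g = begin
      Σℤ xs (λ y → δ y w * g y) ≡⟨ Σℤ-cong xs δ*g≡δ*gw ⟩
      Σℤ xs (λ y → δ y w * g w) ≡⟨ Σℤ-*ʳ xs (g w) (λ y → δ y w) ⟩
      Σℤ xs (λ y → δ y w) * g w ≡⟨ cong (_* g w) (enum w) ⟩
      + 1 * g w                 ≡⟨ ℤP.*-identityˡ (g w) ⟩
      g w                       ∎
      where
        open ≡-Reasoning
        δ*g≡δ*gw : ∀ y → δ y w * g y ≡ δ y w * g w
        δ*g≡δ*gw y with y ≟ w
        ... | yes refl = refl
        ... | no _     = refl

    Σ-δˡ : ∀ w (g : A → ℤ) → Σℤ xs (λ y → δ w y * g y) ≡ g w
    Σ-δˡ w g = trans (Σℤ-cong xs (λ y → cong (_* g y) (δ-sym w y))) (Σ-δ w g)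

    Σ-reindex : (σ τ : A → A) → (∀ y → τ (σ y) ≡ y) → (∀ z → σ (τ z) ≡ z) →
                ∀ g → Σℤ xs (λ y → g (σ y)) ≡ Σℤ xs g
    Σ-reindex σ τ τσ στ g = begin
      Σℤ xs (λ y → g (σ y))                        ≡⟨ Σℤ-cong xs (λ y → sym (Σ-δ (σ y) g)) ⟩
      Σℤ xs (λ y → Σℤ xs (λ z → δ z (σ y) * g z))  ≡⟨ Σℤ-swap xs xs (λ y z → δ z (σ y) * g z) ⟩
      Σℤ xs (λ z → Σℤ xs (λ y → δ z (σ y) * g z))  ≡⟨ Σℤ-cong xs (λ z → Σℤ-*ʳ xs (g z) (λ y → δ z (σ y))) ⟩
      Σℤ xs (λ z → Σℤ xs (λ y → δ z (σ y)) * g z)  ≡⟨ Σℤ-cong xs (λ z → cong (_* g z) (count z)) ⟩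
      Σℤ xs (λ z → + 1 * g z)                      ≡⟨ Σℤ-cong xs (λ z → ℤP.*-identityˡ (g z)) ⟩
      Σℤ xs g                                      ∎
      where
        open ≡-Reasoning
        count : ∀ z → Σℤ xs (λ y → δ z (σ y)) ≡ + 1
        count z = trans (Σℤ-cong xs (λ y → 𝟙-cong (z ≟ σ y) (y ≟ τ z)
                          (λ z≡σy → trans (sym (τσ y)) (cong τ (sym z≡σy)))
                          (λ y≡τz → trans (sym (στ z)) (cong σ (sym y≡τz)))))
                        (enum (τ z))

    Σ-reindex-involution : (σ : A → A) → (∀ y → σ (σ y) ≡ y) →
                           ∀ g → Σℤ xs (λ y → g (σ y)) ≡ Σℤ xs g
    Σ-reindex-involution σ inv = Σ-reindex σ σ inv inv

    Σ-split : ∀ w (g : A → ℤ) → Σℤ xs g ≡ g w + Σℤ xs (λ y → (+ 1 - δ y w) * g y)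
    Σ-split w g = begin
      Σℤ xs g                                                        ≡⟨ Σℤ-cong xs (λ y → split (δ y w) (g y)) ⟩
      Σℤ xs (λ y → δ y w * g y + (+ 1 - δ y w) * g y)                ≡⟨ Σℤ-distrib-+ xs (λ y → δ y w * g y) _ ⟩
      Σℤ xs (λ y → δ y w * g y) + Σℤ xs (λ y → (+ 1 - δ y w) * g y)  ≡⟨ cong (_+ Σℤ xs (λ y → (+ 1 - δ y w) * g y)) (Σ-δ w g) ⟩
      g w + Σℤ xs (λ y → (+ 1 - δ y w) * g y)                        ∎
      where
        open ≡-Reasoning
        split : ∀ d x → x ≡ d * x + (+ 1 - d) * x
        split = solve-∀

module ModularArithmetic (p : ℕ) .{{_ : NonZero p}} where
  open GF p hiding (Σℤ)

  infix 4 _≡ₚ_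
  record _≡ₚ_ (x y : ℤ) : Set where
    constructor mk≡ₚ
    field p∣x-y : + p ℤDiv.∣ x - y

  private
    via : ∀ {x y} d → d ≡ x - y → + p ℤDiv.∣ d → x ≡ₚ y
    via d refl p∣d = mk≡ₚ p∣d

  ≡⇒≡ₚ : ∀ {x y} → x ≡ y → x ≡ₚ y
  ≡⇒≡ₚ {x} refl = mk≡ₚ (divides (+ 0) (ℤP.+-inverseʳ x))

  ≡ₚ-refl : ∀ {x} → x ≡ₚ x
  ≡ₚ-refl = ≡⇒≡ₚ refl

  ≡ₚ-sym : ∀ {x y} → x ≡ₚ y → y ≡ₚ x
  ≡ₚ-sym {x} {y} (mk≡ₚ d) = via (- (x - y)) (flip x y) (ℤDiv.∣m⇒∣-m d)
    where flip : ∀ x y → - (x - y) ≡ y - x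
          flip = solve-∀

  ≡ₚ-trans : ∀ {x y z} → x ≡ₚ y → y ≡ₚ z → x ≡ₚ z
  ≡ₚ-trans {x} {y} {z} (mk≡ₚ d) (mk≡ₚ e) = via ((x - y) + (y - z)) (ℤP.+-minus-telescope x y z) (ℤDiv.∣m∣n⇒∣m+n d e)

  ≡ₚ-setoid : Setoid _ _
  ≡ₚ-setoid = record
    { Carrier = ℤ ; _≈_ = _≡ₚ_
    ; isEquivalence = record { refl = ≡ₚ-refl ; sym = ≡ₚ-sym ; trans = ≡ₚ-trans } }

  +-cong-≡ₚ : ∀ {x x′ y y′} → x ≡ₚ x′ → y ≡ₚ y′ → x + y ≡ₚ x′ + y′
  +-cong-≡ₚ {x} {x′} {y} {y′} (mk≡ₚ d) (mk≡ₚ e) =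
    via ((x - x′) + (y - y′)) (regroup x x′ y y′) (ℤDiv.∣m∣n⇒∣m+n d e)
    where regroup : ∀ x x′ y y′ → (x - x′) + (y - y′) ≡ (x + y) - (x′ + y′)
          regroup = solve-∀

  neg-cong-≡ₚ : ∀ {x y} → x ≡ₚ y → - x ≡ₚ - y
  neg-cong-≡ₚ {x} {y} (mk≡ₚ d) = via (- (x - y)) (regroup x y) (ℤDiv.∣m⇒∣-m d)
    where regroup : ∀ x y → - (x - y) ≡ - x - - y
          regroup = solve-∀

  -‿cong-≡ₚ : ∀ {x x′ y y′} → x ≡ₚ x′ → y ≡ₚ y′ → x - y ≡ₚ x′ - y′
  -‿cong-≡ₚ x≡x′ y≡y′ = +-cong-≡ₚ x≡x′ (neg-cong-≡ₚ y≡y′)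

  *-cong-≡ₚ : ∀ {x x′ y y′} → x ≡ₚ x′ → y ≡ₚ y′ → x * y ≡ₚ x′ * y′
  *-cong-≡ₚ {x} {x′} {y} {y′} (mk≡ₚ d) (mk≡ₚ e) =
    via ((x - x′) * y + x′ * (y - y′)) (regroup x x′ y y′)
        (ℤDiv.∣m∣n⇒∣m+n (ℤDiv.∣m⇒∣m*n y d) (ℤDiv.∣n⇒∣m*n x′ e))
    where regroup : ∀ x x′ y y′ → (x - x′) * y + x′ * (y - y′) ≡ x * y - x′ * y′
          regroup = solve-∀

  p≡ₚ0 : + p ≡ₚ + 0
  p≡ₚ0 = mk≡ₚ (divides (+ 1) (trans (ℤP.+-identityʳ (+ p)) (sym (ℤP.*-identityˡ (+ p)))))

  ∣-<⇒≡0 : ∀ {k} → p ℕDiv.∣ k → k ℕ.< p → k ≡ 0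
  ∣-<⇒≡0 {zero}  _   _   = refl
  ∣-<⇒≡0 {suc k} p∣k k<p = contradiction p∣k (ℕDiv.>⇒∤ k<p)

  ≡ₚ⇒≡ : ∀ {a b} → a ℕ.< p → b ℕ.< p → + a ≡ₚ + b → a ≡ b
  ≡ₚ⇒≡ {a} {b} a<p b<p (mk≡ₚ p∣a-b) =
    ℤP.+-injective (ℤP.i-j≡0⇒i≡j (+ a) (+ b) (ℤP.∣i∣≡0⇒i≡0 (∣-<⇒≡0 (ℤDiv.∣⇒∣ᵤ p∣a-b) ∣a-b∣<p)))
    where
      ∣a-b∣<p : ∣ + a - + b ∣ ℕ.< p
      ∣a-b∣<p = subst (ℕ._< p) (cong ∣_∣ (sym (ℤP.m-n≡m⊖n a b)))
                      (ℕP.≤-<-trans (ℤP.∣m⊝n∣≤m⊔n a b) (ℕP.⊔-lub a<p b<p))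

  ⟦_⟧ : F → ℤ
  ⟦ a ⟧ = + toℕ a

  ⟦⟧-injective : ∀ {a b : F} → ⟦ a ⟧ ≡ₚ ⟦ b ⟧ → a ≡ b
  ⟦⟧-injective {a} {b} e = FinP.toℕ-injective (≡ₚ⇒≡ (FinP.toℕ<n a) (FinP.toℕ<n b) e)

  ⟦mod⟧ : ∀ m → ⟦ m mod p ⟧ ≡ₚ + m
  ⟦mod⟧ m = ≡ₚ-sym (mk≡ₚ (divides (+ (m / p)) (begin
    + m - ⟦ m mod p ⟧              ≡⟨ cong₂ (λ u v → + u - + v) (m≡m%n+[m/n]*n m p) (FinP.toℕ-fromℕ< (m%n<n m p)) ⟩
    + (m % p ℕ.+ m / p ℕ.* p) - + (m % p) ≡⟨ cong (_- + (m % p)) (ℤP.pos-+ (m % p) (m / p ℕ.* p)) ⟩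
    + (m % p) + + (m / p ℕ.* p) - + (m % p) ≡⟨ cancel (+ (m % p)) (+ (m / p ℕ.* p)) ⟩
    + (m / p ℕ.* p)                 ≡⟨ ℤP.pos-* (m / p) p ⟩
    + (m / p) * + p                 ∎)))
    where
      open ≡-Reasoning
      cancel : ∀ a b → a + b - a ≡ b
      cancel = solve-∀

  _⊗_ : F → F → F
  a ⊗ b = (toℕ a ℕ.* toℕ b) mod p

  ⟦0F⟧ : ⟦ 0F ⟧ ≡ₚ + 0
  ⟦0F⟧ = ⟦mod⟧ 0

  toℕ≢0 : ∀ {a : F} → a ≢ 0F → toℕ a ≢ 0
  toℕ≢0 {a} a≢0 toℕa≡0 = a≢0 (⟦⟧-injective (≡ₚ-trans (≡⇒≡ₚ (cong +_ toℕa≡0)) (≡ₚ-sym ⟦0F⟧)))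

  ⟦⊕⟧ : ∀ a b → ⟦ a ⊕ b ⟧ ≡ₚ ⟦ a ⟧ + ⟦ b ⟧
  ⟦⊕⟧ a b = ≡ₚ-trans (⟦mod⟧ (toℕ a ℕ.+ toℕ b)) (≡⇒≡ₚ (ℤP.pos-+ (toℕ a) (toℕ b)))

  ⟦⊗⟧ : ∀ a b → ⟦ a ⊗ b ⟧ ≡ₚ ⟦ a ⟧ * ⟦ b ⟧
  ⟦⊗⟧ a b = ≡ₚ-trans (⟦mod⟧ (toℕ a ℕ.* toℕ b)) (≡⇒≡ₚ (ℤP.pos-* (toℕ a) (toℕ b)))

  ⟦⊖⟧ : ∀ a → ⟦ ⊖ a ⟧ ≡ₚ - ⟦ a ⟧
  ⟦⊖⟧ a = begin
    ⟦ ⊖ a ⟧           ≈⟨ ⟦mod⟧ (p ℕ.∸ toℕ a) ⟩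
    + (p ℕ.∸ toℕ a)   ≡⟨ trans (sym (ℤP.⊖-≥ (ℕP.<⇒≤ (FinP.toℕ<n a)))) (sym (ℤP.m-n≡m⊖n p (toℕ a))) ⟩
    + p - ⟦ a ⟧       ≈⟨ -‿cong-≡ₚ p≡ₚ0 (≡ₚ-refl {⟦ a ⟧}) ⟩
    + 0 - ⟦ a ⟧       ≡⟨ ℤP.+-identityˡ (- ⟦ a ⟧) ⟩
    - ⟦ a ⟧           ∎
    where open SetoidReasoning ≡ₚ-setoid

  ⟦⊖⟧₂ : ∀ a b → ⟦ a ⊖ b ⟧ ≡ₚ ⟦ a ⟧ - ⟦ b ⟧
  ⟦⊖⟧₂ a b = ≡ₚ-trans (⟦⊕⟧ a (⊖ b)) (+-cong-≡ₚ (≡ₚ-refl {⟦ a ⟧}) (⟦⊖⟧ b))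

  -- Identities in GF(p) are proved by mapping both sides to ℤ, where they become ring identities.
  via-ℤ : ∀ {a b : F} {X Y} → ⟦ a ⟧ ≡ₚ X → ⟦ b ⟧ ≡ₚ Y → X ≡ Y → a ≡ b
  via-ℤ a≡X b≡Y refl = ⟦⟧-injective (≡ₚ-trans a≡X (≡ₚ-sym b≡Y))

  private
    ⟦_⟧-refl : ∀ a → ⟦ a ⟧ ≡ₚ ⟦ a ⟧
    ⟦ a ⟧-refl = ≡ₚ-refl {⟦ a ⟧}

  ⊕-comm : ∀ x y → x ⊕ y ≡ y ⊕ x
  ⊕-comm x y = cong (_mod p) (ℕP.+-comm (toℕ x) (toℕ y))

  x⊖[x⊖y]≡y : ∀ x y → x ⊖ (x ⊖ y) ≡ y
  x⊖[x⊖y]≡y x y = via-ℤ (≡ₚ-trans (⟦⊖⟧₂ x (x ⊖ y)) (-‿cong-≡ₚ ⟦ x ⟧-refl (⟦⊖⟧₂ x y))) ⟦ y ⟧-refl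
                        (ring ⟦ x ⟧ ⟦ y ⟧)
    where ring : ∀ x y → x - (x - y) ≡ y
          ring = solve-∀

  ⊖-involutive : ∀ x → ⊖ (⊖ x) ≡ x
  ⊖-involutive x = via-ℤ (≡ₚ-trans (⟦⊖⟧ (⊖ x)) (neg-cong-≡ₚ (⟦⊖⟧ x))) ⟦ x ⟧-refl (ℤP.neg-involutive ⟦ x ⟧)

  [x⊖y]⊖x≡⊖y : ∀ x y → (x ⊖ y) ⊖ x ≡ ⊖ y
  [x⊖y]⊖x≡⊖y x y = via-ℤ (≡ₚ-trans (⟦⊖⟧₂ (x ⊖ y) x) (-‿cong-≡ₚ (⟦⊖⟧₂ x y) ⟦ x ⟧-refl)) (⟦⊖⟧ y)
                         (ring ⟦ x ⟧ ⟦ y ⟧)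
    where ring : ∀ x y → x - y - x ≡ - y
          ring = solve-∀

  0⊖x≡⊖x : ∀ x → 0F ⊖ x ≡ ⊖ x
  0⊖x≡⊖x x = via-ℤ (≡ₚ-trans (⟦⊖⟧₂ 0F x) (-‿cong-≡ₚ ⟦0F⟧ ⟦ x ⟧-refl)) (⟦⊖⟧ x) (ℤP.+-identityˡ (- ⟦ x ⟧))

  x⊖0≡x : ∀ x → x ⊖ 0F ≡ x
  x⊖0≡x x = via-ℤ (≡ₚ-trans (⟦⊖⟧₂ x 0F) (-‿cong-≡ₚ ⟦ x ⟧-refl ⟦0F⟧)) ⟦ x ⟧-refl (ℤP.+-identityʳ ⟦ x ⟧)

  x⊖x≡0 : ∀ x → x ⊖ x ≡ 0F
  x⊖x≡0 x = via-ℤ (⟦⊖⟧₂ x x) ⟦0F⟧ (ℤP.+-inverseʳ ⟦ x ⟧)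

  x⊕⊖x≡0 : ∀ x → x ⊕ (⊖ x) ≡ 0F
  x⊕⊖x≡0 x = via-ℤ (≡ₚ-trans (⟦⊕⟧ x (⊖ x)) (+-cong-≡ₚ ⟦ x ⟧-refl (⟦⊖⟧ x))) ⟦0F⟧ (ℤP.+-inverseʳ ⟦ x ⟧)

  ⊖0≡0 : ⊖ 0F ≡ 0F
  ⊖0≡0 = trans (sym (0⊖x≡⊖x 0F)) (x⊖x≡0 0F)

  x⊖y≡0⇒x≡y : ∀ x y → x ⊖ y ≡ 0F → x ≡ y
  x⊖y≡0⇒x≡y x y x⊖y≡0 = ⟦⟧-injective (begin
    ⟦ x ⟧                 ≡⟨ ring ⟦ x ⟧ ⟦ y ⟧ ⟩
    (⟦ x ⟧ - ⟦ y ⟧) + ⟦ y ⟧ ≈⟨ +-cong-≡ₚ (≡ₚ-sym (⟦⊖⟧₂ x y)) ⟦ y ⟧-refl ⟩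
    ⟦ x ⊖ y ⟧ + ⟦ y ⟧     ≡⟨ cong (λ z → ⟦ z ⟧ + ⟦ y ⟧) x⊖y≡0 ⟩
    ⟦ 0F ⟧ + ⟦ y ⟧        ≈⟨ +-cong-≡ₚ ⟦0F⟧ ⟦ y ⟧-refl ⟩
    + 0 + ⟦ y ⟧           ≡⟨ ℤP.+-identityˡ ⟦ y ⟧ ⟩
    ⟦ y ⟧                 ∎)
    where
      open SetoidReasoning ≡ₚ-setoid
      ring : ∀ x y → x ≡ (x - y) + y
      ring = solve-∀

  [x⊕y]⊖y≡x : ∀ x y → (x ⊕ y) ⊖ y ≡ x
  [x⊕y]⊖y≡x x y = via-ℤ (≡ₚ-trans (⟦⊖⟧₂ (x ⊕ y) y) (-‿cong-≡ₚ (⟦⊕⟧ x y) ⟦ y ⟧-refl)) ⟦ x ⟧-refl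
                        (ring ⟦ x ⟧ ⟦ y ⟧)
    where ring : ∀ x y → x + y - y ≡ x
          ring = solve-∀

  [x⊖y]⊕y≡x : ∀ x y → (x ⊖ y) ⊕ y ≡ x
  [x⊖y]⊕y≡x x y = via-ℤ (≡ₚ-trans (⟦⊕⟧ (x ⊖ y) y) (+-cong-≡ₚ (⟦⊖⟧₂ x y) ⟦ y ⟧-refl)) ⟦ x ⟧-refl
                        (ring ⟦ x ⟧ ⟦ y ⟧)
    where ring : ∀ x y → x - y + y ≡ x
          ring = solve-∀

  x⊖[y⊕z]≡[x⊖z]⊖y : ∀ x y z → x ⊖ (y ⊕ z) ≡ (x ⊖ z) ⊖ y
  x⊖[y⊕z]≡[x⊖z]⊖y x y z =
    via-ℤ (≡ₚ-trans (⟦⊖⟧₂ x (y ⊕ z)) (-‿cong-≡ₚ ⟦ x ⟧-refl (⟦⊕⟧ y z)))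
          (≡ₚ-trans (⟦⊖⟧₂ (x ⊖ z) y) (-‿cong-≡ₚ (⟦⊖⟧₂ x z) ⟦ y ⟧-refl))
          (ring ⟦ x ⟧ ⟦ y ⟧ ⟦ z ⟧)
    where ring : ∀ x y z → x - (y + z) ≡ x - z - y
          ring = solve-∀

  ⊖[x⊖y]≡y⊖x : ∀ x y → ⊖ (x ⊖ y) ≡ y ⊖ x
  ⊖[x⊖y]≡y⊖x x y = via-ℤ (≡ₚ-trans (⟦⊖⟧ (x ⊖ y)) (neg-cong-≡ₚ (⟦⊖⟧₂ x y))) (⟦⊖⟧₂ y x) (ring ⟦ x ⟧ ⟦ y ⟧)
    where ring : ∀ x y → - (x - y) ≡ y - x
          ring = solve-∀

  ⊖x⊖⊖y≡⊖[x⊖y] : ∀ x y → (⊖ x) ⊖ (⊖ y) ≡ ⊖ (x ⊖ y)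
  ⊖x⊖⊖y≡⊖[x⊖y] x y = via-ℤ (≡ₚ-trans (⟦⊖⟧₂ (⊖ x) (⊖ y)) (-‿cong-≡ₚ (⟦⊖⟧ x) (⟦⊖⟧ y)))
                           (≡ₚ-trans (⟦⊖⟧ (x ⊖ y)) (neg-cong-≡ₚ (⟦⊖⟧₂ x y))) (ring ⟦ x ⟧ ⟦ y ⟧)
    where ring : ∀ x y → - x - - y ≡ - (x - y)
          ring = solve-∀

  x⊖⊖y≡y⊕x : ∀ x y → x ⊖ (⊖ y) ≡ y ⊕ x
  x⊖⊖y≡y⊕x x y = via-ℤ (≡ₚ-trans (⟦⊖⟧₂ x (⊖ y)) (-‿cong-≡ₚ ⟦ x ⟧-refl (⟦⊖⟧ y))) (⟦⊕⟧ y x) (ring ⟦ x ⟧ ⟦ y ⟧)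
    where ring : ∀ x y → x - - y ≡ y + x
          ring = solve-∀

  x⊕y≡z⇒x≡z⊖y : ∀ x y z → x ⊕ y ≡ z → x ≡ z ⊖ y
  x⊕y≡z⇒x≡z⊖y x y z refl = sym ([x⊕y]⊖y≡x x y)

  x-ᵥ[x-ᵥy]≡y : ∀ {n} (x y : V n) → x -ᵥ (x -ᵥ y) ≡ y
  x-ᵥ[x-ᵥy]≡y []      []      = refl
  x-ᵥ[x-ᵥy]≡y (a ∷ x) (b ∷ y) = cong₂ _∷_ (x⊖[x⊖y]≡y a b) (x-ᵥ[x-ᵥy]≡y x y)

  -ᵥ-involutive : ∀ {n} (x : V n) → -ᵥ (-ᵥ x) ≡ x
  -ᵥ-involutive []      = refl
  -ᵥ-involutive (a ∷ x) = cong₂ _∷_ (⊖-involutive a) (-ᵥ-involutive x)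

  [x-ᵥy]-ᵥx≡-ᵥy : ∀ {n} (x y : V n) → (x -ᵥ y) -ᵥ x ≡ -ᵥ y
  [x-ᵥy]-ᵥx≡-ᵥy []      []      = refl
  [x-ᵥy]-ᵥx≡-ᵥy (a ∷ x) (b ∷ y) = cong₂ _∷_ ([x⊖y]⊖x≡⊖y a b) ([x-ᵥy]-ᵥx≡-ᵥy x y)

  0-ᵥx≡-ᵥx : ∀ {n} (x : V n) → 0ᵥ -ᵥ x ≡ -ᵥ x
  0-ᵥx≡-ᵥx []      = refl
  0-ᵥx≡-ᵥx (a ∷ x) = cong₂ _∷_ (0⊖x≡⊖x a) (0-ᵥx≡-ᵥx x)

  x-ᵥx≡0 : ∀ {n} (x : V n) → x -ᵥ x ≡ 0ᵥ
  x-ᵥx≡0 []      = refl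
  x-ᵥx≡0 (a ∷ x) = cong₂ _∷_ (x⊖x≡0 a) (x-ᵥx≡0 x)

  x-ᵥy≡0⇒x≡y : ∀ {n} (x y : V n) → x -ᵥ y ≡ 0ᵥ → x ≡ y
  x-ᵥy≡0⇒x≡y []      []      _ = refl
  x-ᵥy≡0⇒x≡y (a ∷ x) (b ∷ y) e =
    cong₂ _∷_ (x⊖y≡0⇒x≡y a b (cong Vec.head e)) (x-ᵥy≡0⇒x≡y x y (cong Vec.tail e))

  -ᵥx≡0⇒x≡0 : ∀ {n} (x : V n) → -ᵥ x ≡ 0ᵥ → x ≡ 0ᵥ
  -ᵥx≡0⇒x≡0 x e = sym (x-ᵥy≡0⇒x≡y 0ᵥ x (trans (0-ᵥx≡-ᵥx x) e))

  -ᵥ0≡0 : ∀ {n} → -ᵥ 0ᵥ ≡ 0ᵥ {n}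
  -ᵥ0≡0 = trans (sym (0-ᵥx≡-ᵥx 0ᵥ)) (x-ᵥx≡0 0ᵥ)

  dotℤ : ∀ {n} → V n → V n → ℤ
  dotℤ []      []      = + 0
  dotℤ (a ∷ x) (b ∷ y) = ⟦ a ⟧ * ⟦ b ⟧ + dotℤ x y

  ⟦⟨⟩⟧ : ∀ {n} (x y : V n) → ⟦ ⟨ x , y ⟩ ⟧ ≡ₚ dotℤ x y
  ⟦⟨⟩⟧ x y = ≡ₚ-trans (⟦mod⟧ _) (≡⇒≡ₚ (sum≡dotℤ x y))
    where
      sum≡dotℤ : ∀ {n} (x y : V n) → + Vec.sum (Vec.zipWith (λ a b → toℕ a ℕ.* toℕ b) x y) ≡ dotℤ x y
      sum≡dotℤ []      []      = refl
      sum≡dotℤ (a ∷ x) (b ∷ y) =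
        trans (ℤP.pos-+ (toℕ a ℕ.* toℕ b) _) (cong₂ _+_ (ℤP.pos-* (toℕ a) (toℕ b)) (sum≡dotℤ x y))

  dotℤ-0ʳ : ∀ {n} (x : V n) → dotℤ x 0ᵥ ≡ₚ + 0
  dotℤ-0ʳ []      = ≡ₚ-refl
  dotℤ-0ʳ (a ∷ x) = ≡ₚ-trans (+-cong-≡ₚ (*-cong-≡ₚ ⟦ a ⟧-refl ⟦0F⟧) (dotℤ-0ʳ x))
                             (≡⇒≡ₚ (cong (_+ + 0) (ℤP.*-zeroʳ ⟦ a ⟧)))

  dotℤ-0ˡ : ∀ {n} (y : V n) → dotℤ 0ᵥ y ≡ₚ + 0
  dotℤ-0ˡ []      = ≡ₚ-refl
  dotℤ-0ˡ (b ∷ y) = ≡ₚ-trans (+-cong-≡ₚ (*-cong-≡ₚ ⟦0F⟧ ⟦ b ⟧-refl) (dotℤ-0ˡ y))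
                             (≡⇒≡ₚ (cong (_+ + 0) (ℤP.*-zeroˡ ⟦ b ⟧)))

  dotℤ-sub : ∀ {n} (x y z : V n) → dotℤ x (y -ᵥ z) ≡ₚ dotℤ x y - dotℤ x z
  dotℤ-sub []      []      []      = ≡ₚ-refl
  dotℤ-sub (a ∷ x) (b ∷ y) (c ∷ z) = begin
    ⟦ a ⟧ * ⟦ b ⊖ c ⟧ + dotℤ x (y -ᵥ z)
      ≈⟨ +-cong-≡ₚ (*-cong-≡ₚ ⟦ a ⟧-refl (⟦⊖⟧₂ b c)) (dotℤ-sub x y z) ⟩
    ⟦ a ⟧ * (⟦ b ⟧ - ⟦ c ⟧) + (dotℤ x y - dotℤ x z)
      ≡⟨ ring ⟦ a ⟧ ⟦ b ⟧ ⟦ c ⟧ (dotℤ x y) (dotℤ x z) ⟩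
    (⟦ a ⟧ * ⟦ b ⟧ + dotℤ x y) - (⟦ a ⟧ * ⟦ c ⟧ + dotℤ x z) ∎
    where
      open SetoidReasoning ≡ₚ-setoid
      ring : ∀ a b c u v → a * (b - c) + (u - v) ≡ (a * b + u) - (a * c + v)
      ring = solve-∀

  ⟨x,0⟩≡0 : ∀ {n} (x : V n) → ⟨ x , 0ᵥ ⟩ ≡ 0F
  ⟨x,0⟩≡0 x = via-ℤ (≡ₚ-trans (⟦⟨⟩⟧ x 0ᵥ) (dotℤ-0ʳ x)) ⟦0F⟧ refl

  ⟨0,y⟩≡0 : ∀ {n} (y : V n) → ⟨ 0ᵥ , y ⟩ ≡ 0F
  ⟨0,y⟩≡0 y = via-ℤ (≡ₚ-trans (⟦⟨⟩⟧ 0ᵥ y) (dotℤ-0ˡ y)) ⟦0F⟧ refl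

  ⟨x,y-ᵥz⟩ : ∀ {n} (x y z : V n) → ⟨ x , y -ᵥ z ⟩ ≡ ⟨ x , y ⟩ ⊖ ⟨ x , z ⟩
  ⟨x,y-ᵥz⟩ x y z = via-ℤ (≡ₚ-trans (⟦⟨⟩⟧ x (y -ᵥ z)) (dotℤ-sub x y z))
                         (≡ₚ-trans (⟦⊖⟧₂ ⟨ x , y ⟩ ⟨ x , z ⟩) (-‿cong-≡ₚ (⟦⟨⟩⟧ x y) (⟦⟨⟩⟧ x z))) refl

  ⟨x,-ᵥy⟩ : ∀ {n} (x y : V n) → ⟨ x , -ᵥ y ⟩ ≡ ⊖ ⟨ x , y ⟩
  ⟨x,-ᵥy⟩ x y = begin
    ⟨ x , -ᵥ y ⟩              ≡⟨ cong ⟨ x ,_⟩ (sym (0-ᵥx≡-ᵥx y)) ⟩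
    ⟨ x , 0ᵥ -ᵥ y ⟩           ≡⟨ ⟨x,y-ᵥz⟩ x 0ᵥ y ⟩
    ⟨ x , 0ᵥ ⟩ ⊖ ⟨ x , y ⟩    ≡⟨ cong (_⊖ ⟨ x , y ⟩) (⟨x,0⟩≡0 x) ⟩
    0F ⊖ ⟨ x , y ⟩            ≡⟨ 0⊖x≡⊖x ⟨ x , y ⟩ ⟩
    ⊖ ⟨ x , y ⟩               ∎
    where open ≡-Reasoning

  ⟨∷,∷⟩ : ∀ {n} a (x : V n) b y → ⟨ a ∷ x , b ∷ y ⟩ ≡ (a ⊗ b) ⊕ ⟨ x , y ⟩
  ⟨∷,∷⟩ a x b y = via-ℤ (⟦⟨⟩⟧ (a ∷ x) (b ∷ y))
                        (≡ₚ-trans (⟦⊕⟧ (a ⊗ b) ⟨ x , y ⟩) (+-cong-≡ₚ (⟦⊗⟧ a b) (⟦⟨⟩⟧ x y))) refl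

  +-multiple-≡ₚ : ∀ x q → x + q * + p ≡ₚ x
  +-multiple-≡ₚ x q = mk≡ₚ (divides q (cancel x (q * + p)))
    where cancel : ∀ x y → x + y - x ≡ y
          cancel = solve-∀

Σℤ-allFin-suc : ∀ n (g : Fin (suc n) → ℤ) → Σℤ (allFin (suc n)) g ≡ g Fin.zero + Σℤ (allFin n) (g ∘ Fin.suc)
Σℤ-allFin-suc n g = cong (_+_ (g Fin.zero)) (begin
  Σℤ (tabulate Fin.suc) g                 ≡⟨ cong (λ xs → Σℤ xs g) (sym (ListP.map-tabulate id Fin.suc)) ⟩
  Σℤ (List.map Fin.suc (allFin n)) g      ≡⟨ Σℤ-map Fin.suc (allFin n) g ⟩
  Σℤ (allFin n) (g ∘ Fin.suc)             ∎)
  where open ≡-Reasoning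

allFin-enumerates : ∀ n → Enumeration.IsEnumeration FinP._≟_ (allFin n)
allFin-enumerates (suc n) w = trans (Σℤ-allFin-suc n (λ y → Enumeration.δ FinP._≟_ y w)) (first+rest≡1 w)
  where
    module E = Enumeration {Fin (suc n)} FinP._≟_
    first+rest≡1 : ∀ w → E.δ Fin.zero w + Σℤ (allFin n) (λ y → E.δ (Fin.suc y) w) ≡ + 1
    first+rest≡1 Fin.zero = cong₂ _+_ (E.δ-refl Fin.zero)
                                      (trans (Σℤ-cong (allFin n) (λ y → 𝟙-no (Fin.suc y FinP.≟ Fin.zero) (λ ())))
                                             (Σℤ-zero (allFin n)))
    first+rest≡1 (Fin.suc w) = trans (ℤP.+-identityˡ _) (trans
      (Σℤ-cong (allFin n) (λ y → 𝟙-cong (Fin.suc y FinP.≟ Fin.suc w) (y FinP.≟ w) FinP.suc-injective (cong Fin.suc)))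
      (allFin-enumerates n w))

module Enumerations (p : ℕ) .{{_ : NonZero p}} where
  open GF p hiding (Σℤ)

  module EnumF = Enumeration {F} FinP._≟_
  module EnumV {n : ℕ} = Enumeration {V n} _≟ᵥ_
  open EnumF using () renaming (δ to δF) public
  open EnumV using () renaming (δ to δV) public

  Fs : List F
  Fs = allFin p

  Fs-enumerates : EnumF.IsEnumeration Fs
  Fs-enumerates = allFin-enumerates p

  module ΣF = EnumF.Sums Fs Fs-enumerates

  Σℤ-allVecs-suc : ∀ n (g : V (suc n) → ℤ) →
                   Σℤ (allVecs (suc n)) g ≡ Σℤ Fs (λ b → Σℤ (allVecs n) (λ y → g (b ∷ y)))
  Σℤ-allVecs-suc n g = trans (Σℤ-concatMap (λ a → List.map (a ∷_) (allVecs n)) Fs g)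
                             (Σℤ-cong Fs (λ b → Σℤ-map (b ∷_) (allVecs n) g))

  allVecs-enumerates : ∀ n → EnumV.IsEnumeration {n} (allVecs n)
  allVecs-enumerates zero    [] = refl
  allVecs-enumerates (suc n) (b ∷ w) = begin
    Σℤ (allVecs (suc n)) (λ y → δV y (b ∷ w))               ≡⟨ Σℤ-allVecs-suc n (λ y → δV y (b ∷ w)) ⟩
    Σℤ Fs (λ a → Σℤ (allVecs n) (λ y → δV (a ∷ y) (b ∷ w))) ≡⟨ Σℤ-cong Fs (λ a → Σℤ-cong (allVecs n) (δV-∷ a)) ⟩
    Σℤ Fs (λ a → Σℤ (allVecs n) (λ y → δF a b * δV y w))    ≡⟨ Σℤ-cong Fs (λ a → Σℤ-*ˡ (allVecs n) (δF a b) (λ y → δV y w)) ⟩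
    Σℤ Fs (λ a → δF a b * Σℤ (allVecs n) (λ y → δV y w))    ≡⟨ Σℤ-cong Fs (λ a → cong (δF a b *_) (allVecs-enumerates n w)) ⟩
    Σℤ Fs (λ a → δF a b * + 1)                              ≡⟨ Σℤ-cong Fs (λ a → ℤP.*-identityʳ (δF a b)) ⟩
    Σℤ Fs (λ a → δF a b)                                    ≡⟨ Fs-enumerates b ⟩
    + 1                                                     ∎
    where
      open ≡-Reasoning
      δV-∷ : ∀ a y → δV (a ∷ y) (b ∷ w) ≡ δF a b * δV y w
      δV-∷ a y = 𝟙-× (a FinP.≟ b) (y ≟ᵥ w) ((a ∷ y) ≟ᵥ (b ∷ w)) (cong Vec.head) (cong Vec.tail) (cong₂ _∷_)

  module ΣV {n : ℕ} = EnumV.Sums (allVecs n) (allVecs-enumerates n)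

  Σℤ-Fs-const : ∀ c → Σℤ Fs (λ _ → c) ≡ + p * c
  Σℤ-Fs-const c = trans (Σℤ-const Fs c) (cong (λ n → + n * c) (ListP.length-tabulate {n = p} id))

  fibre : ∀ {n} → V n → F → ℤ
  fibre {n} a k = Σℤ (allVecs n) (λ d → δF ⟨ a , d ⟩ k)

module Cyclotomic (p : ℕ) .{{_ : NonZero p}} where
  open GF p hiding (Σℤ)
  open ModularArithmetic p
  open Enumerations p

  infix 4 _≃_
  record _≃_ (a b : Cyc) : Set where
    constructor mk≃
    field
      offset : ℤ
      a-b≡offset : ∀ j → a j - b j ≡ offset

  ≃-refl : ∀ {a} → a ≃ a
  ≃-refl {a} = mk≃ (+ 0) (λ j → ℤP.+-inverseʳ (a j))

  ≗⇒≃ : ∀ {a b} → a ≗ b → a ≃ b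
  ≗⇒≃ {a} {b} a≗b = mk≃ (+ 0) (λ j → trans (cong (_- b j) (a≗b j)) (ℤP.+-inverseʳ (b j)))

  ≃-sym : ∀ {a b} → a ≃ b → b ≃ a
  ≃-sym {a} {b} (mk≃ t e) = mk≃ (- t) (λ j → trans (flip (a j) (b j)) (cong -_ (e j)))
    where flip : ∀ x y → y - x ≡ - (x - y)
          flip = solve-∀

  ≃-trans : ∀ {a b c} → a ≃ b → b ≃ c → a ≃ c
  ≃-trans {a} {b} {c} (mk≃ t e) (mk≃ s e′) = mk≃ (t + s) (λ j → trans (telescope (a j) (b j) (c j)) (cong₂ _+_ (e j) (e′ j)))
    where telescope : ∀ x y z → x - z ≡ (x - y) + (y - z)
          telescope = solve-∀

  ≃-setoid : Setoid _ _
  ≃-setoid = record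
    { Carrier = Cyc ; _≈_ = _≃_
    ; isEquivalence = record { refl = ≃-refl ; sym = ≃-sym ; trans = ≃-trans } }

  ≃⇒≈ᶜ : ∀ {a b} → a ≃ b → a ≈ᶜ b
  ≃⇒≈ᶜ (mk≃ t e) = t , e

  ≃⇒≡+ : ∀ {a b} (a≃b : a ≃ b) → ∀ j → a j ≡ b j + _≃_.offset a≃b
  ≃⇒≡+ {a} {b} (mk≃ t e) j = trans (ring (a j) (b j)) (cong (_+_ (b j)) (e j))
    where ring : ∀ x y → x ≡ y + (x - y)
          ring = solve-∀

  const⇒≃0 : ∀ (a : Cyc) c → (∀ j → a j ≡ c) → a ≃ 0ᶜ
  const⇒≃0 a c e = mk≃ c (λ j → trans (ℤP.+-identityʳ (a j)) (e j))

  infixr 8 _·_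
  _·_ : ℤ → Cyc → Cyc
  (z · a) j = z * a j

  1ᶜ : Cyc
  1ᶜ = ζ^ 0F

  +ᶜ-cong : ∀ {a a′ b b′} → a ≃ a′ → b ≃ b′ → (a +ᶜ b) ≃ (a′ +ᶜ b′)
  +ᶜ-cong {a} {a′} {b} {b′} (mk≃ t e) (mk≃ s e′) =
    mk≃ (t + s) (λ j → trans (regroup (a j) (a′ j) (b j) (b′ j)) (cong₂ _+_ (e j) (e′ j)))
    where regroup : ∀ x x′ y y′ → (x + y) - (x′ + y′) ≡ (x - x′) + (y - y′)
          regroup = solve-∀

  ·-congˡ : ∀ z {a a′} → a ≃ a′ → (z · a) ≃ (z · a′)
  ·-congˡ z {a} {a′} (mk≃ t e) = mk≃ (z * t) (λ j → trans (factor z (a j) (a′ j)) (cong (z *_) (e j)))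
    where factor : ∀ z x y → z * x - z * y ≡ z * (x - y)
          factor = solve-∀

  ·-·≗* : ∀ z w a → z · (w · a) ≗ (z * w) · a
  ·-·≗* z w a j = sym (ℤP.*-assoc z w (a j))

  ·-zeroʳ : ∀ z → z · 0ᶜ ≗ 0ᶜ
  ·-zeroʳ z j = ℤP.*-zeroʳ z

  Σℤ-Fs-reflect : ∀ k (b : Cyc) → Σℤ Fs (λ i → b (k ⊖ i)) ≡ Σℤ Fs b
  Σℤ-Fs-reflect k = ΣF.Σ-reindex-involution (_⊖_ k) (x⊖[x⊖y]≡y k)

  *ᶜ-comm : ∀ a b → a *ᶜ b ≗ b *ᶜ a
  *ᶜ-comm a b k = begin
    Σℤ Fs (λ i → a i * b (k ⊖ i))                 ≡⟨ sym (Σℤ-Fs-reflect k (λ i → a i * b (k ⊖ i))) ⟩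
    Σℤ Fs (λ i → a (k ⊖ i) * b (k ⊖ (k ⊖ i)))     ≡⟨ Σℤ-cong Fs (λ i → cong (λ x → a (k ⊖ i) * b x) (x⊖[x⊖y]≡y k i)) ⟩
    Σℤ Fs (λ i → a (k ⊖ i) * b i)                 ≡⟨ Σℤ-cong Fs (λ i → ℤP.*-comm (a (k ⊖ i)) (b i)) ⟩
    Σℤ Fs (λ i → b i * a (k ⊖ i))                 ∎
    where open ≡-Reasoning

  *ᶜ-distribˡ-+ᶜ : ∀ a b c → a *ᶜ (b +ᶜ c) ≗ (a *ᶜ b) +ᶜ (a *ᶜ c)
  *ᶜ-distribˡ-+ᶜ a b c k = trans (Σℤ-cong Fs (λ i → ℤP.*-distribˡ-+ (a i) (b (k ⊖ i)) (c (k ⊖ i))))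
                                 (Σℤ-distrib-+ Fs (λ i → a i * b (k ⊖ i)) (λ i → a i * c (k ⊖ i)))

  *ᶜ-·ʳ : ∀ z a b → a *ᶜ (z · b) ≗ z · (a *ᶜ b)
  *ᶜ-·ʳ z a b k = trans (Σℤ-cong Fs (λ i → swap (a i) z (b (k ⊖ i)))) (Σℤ-*ˡ Fs z (λ i → a i * b (k ⊖ i)))
    where swap : ∀ x z y → x * (z * y) ≡ z * (x * y)
          swap = solve-∀

  *ᶜ-·ˡ : ∀ z a b → (z · a) *ᶜ b ≃ z · (a *ᶜ b)
  *ᶜ-·ˡ z a b = ≗⇒≃ (λ k → trans (*ᶜ-comm (z · a) b k) (trans (*ᶜ-·ʳ z b a k) (cong (z *_) (*ᶜ-comm b a k))))

  *ᶜ-congˡ : ∀ {a a′} b → a ≃ a′ → (a *ᶜ b) ≃ (a′ *ᶜ b)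
  *ᶜ-congˡ {a} {a′} b a≃a′ = mk≃ (t * Σℤ Fs b) (λ k → begin
    (a *ᶜ b) k - (a′ *ᶜ b) k                     ≡⟨ cong (_- (a′ *ᶜ b) k) (expand k) ⟩
    (a′ *ᶜ b) k + t * Σℤ Fs b - (a′ *ᶜ b) k      ≡⟨ cancel ((a′ *ᶜ b) k) (t * Σℤ Fs b) ⟩
    t * Σℤ Fs b                                  ∎)
    where
      open ≡-Reasoning
      t = _≃_.offset a≃a′
      cancel : ∀ x y → x + y - x ≡ y
      cancel = solve-∀
      expand : ∀ k → (a *ᶜ b) k ≡ (a′ *ᶜ b) k + t * Σℤ Fs b
      expand k = begin
        Σℤ Fs (λ i → a i * b (k ⊖ i))                              ≡⟨ Σℤ-cong Fs (λ i → trans (cong (_* b (k ⊖ i)) (≃⇒≡+ a≃a′ i)) (ℤP.*-distribʳ-+ (b (k ⊖ i)) (a′ i) t)) ⟩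
        Σℤ Fs (λ i → a′ i * b (k ⊖ i) + t * b (k ⊖ i))             ≡⟨ Σℤ-distrib-+ Fs (λ i → a′ i * b (k ⊖ i)) (λ i → t * b (k ⊖ i)) ⟩
        (a′ *ᶜ b) k + Σℤ Fs (λ i → t * b (k ⊖ i))                  ≡⟨ cong (_+_ ((a′ *ᶜ b) k)) (trans (Σℤ-*ˡ Fs t (λ i → b (k ⊖ i))) (cong (t *_) (Σℤ-Fs-reflect k b))) ⟩
        (a′ *ᶜ b) k + t * Σℤ Fs b                                  ∎

  *ᶜ-congʳ : ∀ a {b b′} → b ≃ b′ → (a *ᶜ b) ≃ (a *ᶜ b′)
  *ᶜ-congʳ a {b} {b′} b≃b′ = ≃-trans (≗⇒≃ (*ᶜ-comm a b)) (≃-trans (*ᶜ-congˡ a b≃b′) (≗⇒≃ (*ᶜ-comm b′ a)))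

  *ᶜ-cong : ∀ {a a′ b b′} → a ≃ a′ → b ≃ b′ → (a *ᶜ b) ≃ (a′ *ᶜ b′)
  *ᶜ-cong {a′ = a′} {b = b} a≃a′ b≃b′ = ≃-trans (*ᶜ-congˡ b a≃a′) (*ᶜ-congʳ a′ b≃b′)

  *ᶜ-assoc : ∀ a b c → (a *ᶜ b) *ᶜ c ≗ a *ᶜ (b *ᶜ c)
  *ᶜ-assoc a b c k = begin
    Σℤ Fs (λ i → Σℤ Fs (λ j → a j * b (i ⊖ j)) * c (k ⊖ i))
      ≡⟨ Σℤ-cong Fs (λ i → sym (Σℤ-*ʳ Fs (c (k ⊖ i)) (λ j → a j * b (i ⊖ j)))) ⟩
    Σℤ Fs (λ i → Σℤ Fs (λ j → a j * b (i ⊖ j) * c (k ⊖ i)))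
      ≡⟨ Σℤ-swap Fs Fs (λ i j → a j * b (i ⊖ j) * c (k ⊖ i)) ⟩
    Σℤ Fs (λ j → Σℤ Fs (λ i → a j * b (i ⊖ j) * c (k ⊖ i)))
      ≡⟨ Σℤ-cong Fs (λ j → sym (ΣF.Σ-reindex (_⊕ j) (_⊖ j) (λ l → [x⊕y]⊖y≡x l j) (λ i → [x⊖y]⊕y≡x i j) (λ i → a j * b (i ⊖ j) * c (k ⊖ i)))) ⟩
    Σℤ Fs (λ j → Σℤ Fs (λ l → a j * b ((l ⊕ j) ⊖ j) * c (k ⊖ (l ⊕ j))))
      ≡⟨ Σℤ-cong Fs (λ j → Σℤ-cong Fs (λ l → trans (cong₂ (λ x y → a j * b x * c y) ([x⊕y]⊖y≡x l j) (x⊖[y⊕z]≡[x⊖z]⊖y k l j))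
                                                  (ℤP.*-assoc (a j) (b l) (c ((k ⊖ j) ⊖ l))))) ⟩
    Σℤ Fs (λ j → Σℤ Fs (λ l → a j * (b l * c ((k ⊖ j) ⊖ l))))
      ≡⟨ Σℤ-cong Fs (λ j → Σℤ-*ˡ Fs (a j) (λ l → b l * c ((k ⊖ j) ⊖ l))) ⟩
    Σℤ Fs (λ j → a j * Σℤ Fs (λ l → b l * c ((k ⊖ j) ⊖ l))) ∎
    where open ≡-Reasoning

  *ᶜ-zeroˡ : ∀ a → 0ᶜ *ᶜ a ≃ 0ᶜ
  *ᶜ-zeroˡ a = const⇒≃0 (0ᶜ *ᶜ a) (+ 0) (λ k → trans (Σℤ-cong Fs (λ i → ℤP.*-zeroˡ (a (k ⊖ i)))) (Σℤ-zero Fs))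

  *ᶜ-interchange : ∀ a b c d → (a *ᶜ b) *ᶜ (c *ᶜ d) ≃ (a *ᶜ c) *ᶜ (b *ᶜ d)
  *ᶜ-interchange a b c d = begin
    (a *ᶜ b) *ᶜ (c *ᶜ d)  ≈⟨ ≗⇒≃ (*ᶜ-assoc a b (c *ᶜ d)) ⟩
    a *ᶜ (b *ᶜ (c *ᶜ d))  ≈⟨ *ᶜ-congʳ a (≗⇒≃ (λ k → sym (*ᶜ-assoc b c d k))) ⟩
    a *ᶜ ((b *ᶜ c) *ᶜ d)  ≈⟨ *ᶜ-congʳ a (*ᶜ-congˡ d (≗⇒≃ (*ᶜ-comm b c))) ⟩
    a *ᶜ ((c *ᶜ b) *ᶜ d)  ≈⟨ *ᶜ-congʳ a (≗⇒≃ (*ᶜ-assoc c b d)) ⟩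
    a *ᶜ (c *ᶜ (b *ᶜ d))  ≈⟨ ≗⇒≃ (λ k → sym (*ᶜ-assoc a c (b *ᶜ d) k)) ⟩
    (a *ᶜ c) *ᶜ (b *ᶜ d)  ∎
    where open SetoidReasoning ≃-setoid

  ζ^≡δ : ∀ a i → ζ^ a i ≡ δF i a
  ζ^≡δ a i with i FinP.≟ a
  ... | yes _ = refl
  ... | no _  = refl

  ζ^-*ᶜ : ∀ a b → ζ^ a *ᶜ b ≗ (λ k → b (k ⊖ a))
  ζ^-*ᶜ a b k = trans (Σℤ-cong Fs (λ i → cong (_* b (k ⊖ i)) (ζ^≡δ a i))) (ΣF.Σ-δ a (λ i → b (k ⊖ i)))

  *ᶜ-identityˡ : ∀ b → 1ᶜ *ᶜ b ≗ b
  *ᶜ-identityˡ b k = trans (ζ^-*ᶜ 0F b k) (cong b (x⊖0≡x k))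

  *ᶜ-identityʳ : ∀ a → a *ᶜ 1ᶜ ≗ a
  *ᶜ-identityʳ a k = trans (*ᶜ-comm a 1ᶜ k) (*ᶜ-identityˡ a k)

  *ᶜ-·1ᶜ : ∀ z b → b *ᶜ (z · 1ᶜ) ≗ z · b
  *ᶜ-·1ᶜ z b k = trans (*ᶜ-·ʳ z b 1ᶜ k) (cong (z *_) (*ᶜ-identityʳ b k))

  ζ^-*ᶜ-ζ^ : ∀ a b → ζ^ a *ᶜ ζ^ b ≗ ζ^ (a ⊕ b)
  ζ^-*ᶜ-ζ^ a b k = begin
    (ζ^ a *ᶜ ζ^ b) k  ≡⟨ ζ^-*ᶜ a (ζ^ b) k ⟩
    ζ^ b (k ⊖ a)      ≡⟨ ζ^≡δ b (k ⊖ a) ⟩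
    δF (k ⊖ a) b      ≡⟨ 𝟙-cong ((k ⊖ a) FinP.≟ b) (k FinP.≟ (a ⊕ b))
                               (λ e → trans (sym ([x⊖y]⊕y≡x k a)) (trans (cong (_⊕ a) e) (⊕-comm b a)))
                               (λ e → trans (cong (_⊖ a) (trans e (⊕-comm a b))) ([x⊕y]⊖y≡x b a)) ⟩
    δF k (a ⊕ b)      ≡⟨ sym (ζ^≡δ (a ⊕ b) k) ⟩
    ζ^ (a ⊕ b) k      ∎
    where open ≡-Reasoning

  constᶜ≗·1ᶜ : ∀ z → constᶜ z ≗ z · 1ᶜ
  constᶜ≗·1ᶜ z j with j FinP.≟ 0F
  ... | yes _ = sym (ℤP.*-identityʳ z)
  ... | no _  = sym (ℤP.*-zeroʳ z)

  conj-*ᶜ : ∀ a b → conj (a *ᶜ b) ≗ conj a *ᶜ conj b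
  conj-*ᶜ a b k = begin
    Σℤ Fs (λ i → a i * b ((⊖ k) ⊖ i))                ≡⟨ sym (ΣF.Σ-reindex-involution ⊖_ ⊖-involutive (λ i → a i * b ((⊖ k) ⊖ i))) ⟩
    Σℤ Fs (λ i → a (⊖ i) * b ((⊖ k) ⊖ (⊖ i)))        ≡⟨ Σℤ-cong Fs (λ i → cong (λ x → a (⊖ i) * b x) (⊖x⊖⊖y≡⊖[x⊖y] k i)) ⟩
    Σℤ Fs (λ i → a (⊖ i) * b (⊖ (k ⊖ i)))            ∎
    where open ≡-Reasoning

  conj-cong : ∀ {a b} → a ≃ b → conj a ≃ conj b
  conj-cong (mk≃ t e) = mk≃ t (λ j → e (⊖ j))

  conj-ζ^ : ∀ a → conj (ζ^ a) ≗ ζ^ (⊖ a)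
  conj-ζ^ a j = begin
    ζ^ a (⊖ j)     ≡⟨ ζ^≡δ a (⊖ j) ⟩
    δF (⊖ j) a     ≡⟨ 𝟙-cong ((⊖ j) FinP.≟ a) (j FinP.≟ (⊖ a))
                            (λ e → trans (sym (⊖-involutive j)) (cong ⊖_ e))
                            (λ e → trans (cong ⊖_ e) (⊖-involutive a)) ⟩
    δF j (⊖ a)     ≡⟨ sym (ζ^≡δ (⊖ a) j) ⟩
    ζ^ (⊖ a) j     ∎
    where open ≡-Reasoning

  conj-1ᶜ : conj 1ᶜ ≗ 1ᶜ
  conj-1ᶜ j = trans (conj-ζ^ 0F j) (cong (λ x → ζ^ x j) ⊖0≡0)

  ·1ᶜ-norm : ∀ z → (z · 1ᶜ) *ᶜ conj (z · 1ᶜ) ≃ (z * z) · 1ᶜ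
  ·1ᶜ-norm z = ≗⇒≃ (λ k → begin
    ((z · 1ᶜ) *ᶜ conj (z · 1ᶜ)) k  ≡⟨ Σℤ-cong Fs (λ i → cong ((z · 1ᶜ) i *_) (cong (z *_) (conj-1ᶜ (k ⊖ i)))) ⟩
    ((z · 1ᶜ) *ᶜ (z · 1ᶜ)) k       ≡⟨ *ᶜ-·1ᶜ z (z · 1ᶜ) k ⟩
    z * (z * 1ᶜ k)                 ≡⟨ ·-·≗* z z 1ᶜ k ⟩
    (z * z) * 1ᶜ k                 ∎)
    where open ≡-Reasoning

  module _ {A : Set} where

    Σᶜ-pointwise : ∀ (xs : List A) (g : A → Cyc) j → Σᶜ xs g j ≡ Σℤ xs (λ x → g x j)
    Σᶜ-pointwise []       g j = refl
    Σᶜ-pointwise (x ∷ xs) g j = cong (_+_ (g x j)) (Σᶜ-pointwise xs g j)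

    Σᶜ-cong : ∀ (xs : List A) {g h : A → Cyc} → (∀ x → g x ≃ h x) → Σᶜ xs g ≃ Σᶜ xs h
    Σᶜ-cong []       e = ≃-refl {0ᶜ}
    Σᶜ-cong (x ∷ xs) e = +ᶜ-cong (e x) (Σᶜ-cong xs e)

    Σᶜ-zero : ∀ (xs : List A) → Σᶜ xs (λ _ → 0ᶜ) ≃ 0ᶜ
    Σᶜ-zero xs = ≗⇒≃ (λ j → trans (Σᶜ-pointwise xs (λ _ → 0ᶜ) j) (Σℤ-zero xs))

    Σᶜ-· : ∀ (xs : List A) z (g : A → Cyc) → Σᶜ xs (λ x → z · g x) ≗ z · Σᶜ xs g
    Σᶜ-· xs z g j = trans (Σᶜ-pointwise xs (λ x → z · g x) j)
                          (trans (Σℤ-*ˡ xs z (λ x → g x j)) (cong (z *_) (sym (Σᶜ-pointwise xs g j))))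

    *ᶜ-Σᶜ : ∀ (a : Cyc) (xs : List A) (g : A → Cyc) → a *ᶜ Σᶜ xs g ≃ Σᶜ xs (λ x → a *ᶜ g x)
    *ᶜ-Σᶜ a []       g = ≃-trans (≗⇒≃ (*ᶜ-comm a 0ᶜ)) (*ᶜ-zeroˡ a)
    *ᶜ-Σᶜ a (x ∷ xs) g = ≃-trans (≗⇒≃ (*ᶜ-distribˡ-+ᶜ a (g x) (Σᶜ xs g))) (+ᶜ-cong (≃-refl {a *ᶜ g x}) (*ᶜ-Σᶜ a xs g))

    Σᶜ-*ᶜ : ∀ (xs : List A) (g : A → Cyc) b → Σᶜ xs g *ᶜ b ≃ Σᶜ xs (λ x → g x *ᶜ b)
    Σᶜ-*ᶜ xs g b = ≃-trans (≗⇒≃ (*ᶜ-comm (Σᶜ xs g) b))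
                           (≃-trans (*ᶜ-Σᶜ b xs g) (Σᶜ-cong xs (λ x → ≗⇒≃ (*ᶜ-comm b (g x)))))

    conj-Σᶜ : ∀ (xs : List A) (g : A → Cyc) → conj (Σᶜ xs g) ≗ Σᶜ xs (λ x → conj (g x))
    conj-Σᶜ []       g j = refl
    conj-Σᶜ (x ∷ xs) g j = cong (_+_ (g x (⊖ j))) (conj-Σᶜ xs g j)

  -- The trace of ℚ(ζ)/ℚ: Tr (Σ_j a_j ζ^j) = (p - 1) a₀ - Σ_{j ≠ 0} a_j, which ignores constant shifts of a.
  Tr : Cyc → ℤ
  Tr a = + p * a 0F - Σℤ Fs a

  Tr-cong : ∀ {a b} → a ≃ b → Tr a ≡ Tr b
  Tr-cong {a} {b} a≃b = begin
    + p * a 0F - Σℤ Fs a               ≡⟨ cong₂ (λ x y → + p * x - y) (≃⇒≡+ a≃b 0F) Σa ⟩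
    + p * (b 0F + t) - (Σℤ Fs b + + p * t) ≡⟨ cancel (+ p) (b 0F) t (Σℤ Fs b) ⟩
    + p * b 0F - Σℤ Fs b               ∎
    where
      open ≡-Reasoning
      t = _≃_.offset a≃b
      Σa : Σℤ Fs a ≡ Σℤ Fs b + + p * t
      Σa = trans (Σℤ-cong Fs (≃⇒≡+ a≃b)) (trans (Σℤ-distrib-+ Fs b (λ _ → t)) (cong (_+_ (Σℤ Fs b)) (Σℤ-Fs-const t)))
      cancel : ∀ P b₀ t S → P * (b₀ + t) - (S + P * t) ≡ P * b₀ - S
      cancel = solve-∀

  Tr-+ᶜ : ∀ a b → Tr (a +ᶜ b) ≡ Tr a + Tr b
  Tr-+ᶜ a b = trans (cong (λ x → + p * (a 0F + b 0F) - x) (Σℤ-distrib-+ Fs a b)) (ring (+ p) (a 0F) (b 0F) (Σℤ Fs a) (Σℤ Fs b))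
    where ring : ∀ P x y A B → P * (x + y) - (A + B) ≡ (P * x - A) + (P * y - B)
          ring = solve-∀

  Tr-· : ∀ z a → Tr (z · a) ≡ z * Tr a
  Tr-· z a = trans (cong (λ x → + p * (z * a 0F) - x) (Σℤ-*ˡ Fs z a)) (ring (+ p) z (a 0F) (Σℤ Fs a))
    where ring : ∀ P z x A → P * (z * x) - z * A ≡ z * (P * x - A)
          ring = solve-∀

  Tr-Σᶜ : ∀ {A : Set} (xs : List A) (g : A → Cyc) → Tr (Σᶜ xs g) ≡ Σℤ xs (λ x → Tr (g x))
  Tr-Σᶜ []       g = trans (cong (λ x → + p * + 0 - x) (Σℤ-zero Fs)) (cong (_- + 0) (ℤP.*-zeroʳ (+ p)))
  Tr-Σᶜ (x ∷ xs) g = trans (Tr-+ᶜ (g x) (Σᶜ xs g)) (cong (_+_ (Tr (g x))) (Tr-Σᶜ xs g))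

  [a*ᶜconj-a]₀ : ∀ a → (a *ᶜ conj a) 0F ≡ Σℤ Fs (λ i → a i * a i)
  [a*ᶜconj-a]₀ a = Σℤ-cong Fs (λ i → cong (λ x → a i * a x) (trans (cong ⊖_ (0⊖x≡⊖x i)) (⊖-involutive i)))

  Σ[a*ᶜconj-a] : ∀ a → Σℤ Fs (a *ᶜ conj a) ≡ Σℤ Fs a * Σℤ Fs a
  Σ[a*ᶜconj-a] a = begin
    Σℤ Fs (λ k → Σℤ Fs (λ i → a i * a (⊖ (k ⊖ i))))  ≡⟨ Σℤ-swap Fs Fs (λ k i → a i * a (⊖ (k ⊖ i))) ⟩
    Σℤ Fs (λ i → Σℤ Fs (λ k → a i * a (⊖ (k ⊖ i))))  ≡⟨ Σℤ-cong Fs (λ i → Σℤ-*ˡ Fs (a i) (λ k → a (⊖ (k ⊖ i)))) ⟩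
    Σℤ Fs (λ i → a i * Σℤ Fs (λ k → a (⊖ (k ⊖ i))))  ≡⟨ Σℤ-cong Fs (λ i → cong (a i *_) (inner i)) ⟩
    Σℤ Fs (λ i → a i * Σℤ Fs a)                       ≡⟨ Σℤ-*ʳ Fs (Σℤ Fs a) a ⟩
    Σℤ Fs a * Σℤ Fs a                                 ∎
    where
      open ≡-Reasoning
      inner : ∀ i → Σℤ Fs (λ k → a (⊖ (k ⊖ i))) ≡ Σℤ Fs a
      inner i = trans (Σℤ-cong Fs (λ k → cong a (⊖[x⊖y]≡y⊖x k i))) (Σℤ-Fs-reflect i a)

  p*Tr[a*ᶜconj-a] : ∀ a → + p * Tr (a *ᶜ conj a) ≡ Σℤ Fs (λ j → (+ p * a j - Σℤ Fs a) * (+ p * a j - Σℤ Fs a))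
  p*Tr[a*ᶜconj-a] a = sym (begin
    Σℤ Fs (λ j → (P * a j - S) * (P * a j - S))
      ≡⟨ Σℤ-cong Fs (λ j → expand P (a j) S) ⟩
    Σℤ Fs (λ j → (P * P) * (a j * a j) + (- (+ 2 * P * S)) * a j + (S * S) * + 1)
      ≡⟨ Σℤ-linear₃ Fs (P * P) (- (+ 2 * P * S)) (S * S) (λ j → a j * a j) a (λ _ → + 1) ⟩
    (P * P) * Q + (- (+ 2 * P * S)) * S + (S * S) * Σℤ Fs (λ _ → + 1)
      ≡⟨ cong (λ x → (P * P) * Q + (- (+ 2 * P * S)) * S + (S * S) * x) (Σℤ-Fs-const (+ 1)) ⟩
    (P * P) * Q + (- (+ 2 * P * S)) * S + (S * S) * (P * + 1)
      ≡⟨ collect P Q S ⟩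
    P * (P * Q - S * S)
      ≡⟨ cong₂ (λ x y → P * (P * x - y)) (sym ([a*ᶜconj-a]₀ a)) (sym (Σ[a*ᶜconj-a] a)) ⟩
    P * Tr (a *ᶜ conj a) ∎)
    where
      open ≡-Reasoning
      P = + p
      S = Σℤ Fs a
      Q = Σℤ Fs (λ i → a i * a i)
      expand : ∀ P x S → (P * x - S) * (P * x - S) ≡ (P * P) * (x * x) + (- (+ 2 * P * S)) * x + (S * S) * + 1
      expand = solve-∀
      collect : ∀ P Q S → (P * P) * Q + (- (+ 2 * P * S)) * S + (S * S) * (P * + 1) ≡ P * (P * Q - S * S)
      collect = solve-∀

  Tr[a*ᶜconj-a]-nonneg : ∀ a → + 0 ≤ Tr (a *ᶜ conj a)
  Tr[a*ᶜconj-a]-nonneg a = *-nonneg⇒nonneg p (Tr (a *ᶜ conj a)) (subst (+ 0 ≤_) (sym (p*Tr[a*ᶜconj-a] a))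
                                             (Σℤ-nonneg Fs _ (λ j → square-nonneg (+ p * a j - Σℤ Fs a))))

  Tr[a*ᶜconj-a]≡0⇒≃0 : ∀ a → Tr (a *ᶜ conj a) ≡ + 0 → a ≃ 0ᶜ
  Tr[a*ᶜconj-a]≡0⇒≃0 a Tr≡0 = const⇒≃0 a (a 0F) (λ j → ℤP.*-cancelˡ-≡ (+ p) (a j) (a 0F) (trans (p*a≡S j) (sym (p*a≡S 0F))))
    where
      S = Σℤ Fs a
      squares≡0 : Σℤ Fs (λ j → (+ p * a j - S) * (+ p * a j - S)) ≡ + 0
      squares≡0 = trans (sym (p*Tr[a*ᶜconj-a] a)) (trans (cong (+ p *_) Tr≡0) (ℤP.*-zeroʳ (+ p)))
      p*a≡S : ∀ j → + p * a j ≡ S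
      p*a≡S j = ℤP.i-j≡0⇒i≡j (+ p * a j) S (square≡0⇒≡0 (+ p * a j - S)
                  (Σℤ-nonneg-≡0 Fs _ (λ j → square-nonneg (+ p * a j - S)) squares≡0 (∈-allFin j)))

  Σᶜ-Fs-single : ∀ d (g : F → Cyc) → (∀ c → c ≢ d → g c ≃ 0ᶜ) → Σᶜ Fs g ≃ g d
  Σᶜ-Fs-single d g g≃0 = begin
    Σᶜ Fs g                                        ≈⟨ ≗⇒≃ split ⟩
    g d +ᶜ Σᶜ Fs (λ c → (+ 1 - δF c d) · g c)      ≈⟨ +ᶜ-cong (≃-refl {g d}) (≃-trans (Σᶜ-cong Fs others≃0) (Σᶜ-zero Fs)) ⟩
    g d +ᶜ 0ᶜ                                      ≈⟨ ≗⇒≃ (λ j → ℤP.+-identityʳ (g d j)) ⟩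
    g d                                            ∎
    where
      open SetoidReasoning ≃-setoid
      split : Σᶜ Fs g ≗ g d +ᶜ Σᶜ Fs (λ c → (+ 1 - δF c d) · g c)
      split j = trans (Σᶜ-pointwise Fs g j) (trans (ΣF.Σ-split d (λ c → g c j))
                      (cong (_+_ (g d j)) (sym (Σᶜ-pointwise Fs (λ c → (+ 1 - δF c d) · g c) j))))
      others≃0 : ∀ c → (+ 1 - δF c d) · g c ≃ 0ᶜ
      others≃0 c with c FinP.≟ d
      ... | yes refl = ≗⇒≃ (λ j → ℤP.*-zeroˡ (g c j))
      ... | no c≢d   = ≃-trans (·-congˡ (+ 1) (g≃0 c c≢d)) (≗⇒≃ (·-zeroʳ (+ 1)))

  Σζ^*ᶜ : (F → Cyc) → Cyc
  Σζ^*ᶜ Y = Σᶜ Fs (λ c → ζ^ c *ᶜ Y c)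

  Σζ^*ᶜ-pointwise : ∀ Y j → Σζ^*ᶜ Y j ≡ Σℤ Fs (λ c → Y c (j ⊖ c))
  Σζ^*ᶜ-pointwise Y j = trans (Σᶜ-pointwise Fs (λ c → ζ^ c *ᶜ Y c) j) (Σℤ-cong Fs (λ c → ζ^-*ᶜ c (Y c) j))

  Σζ^*ᶜ-+ᶜ : ∀ Y Z → Σζ^*ᶜ (λ c → Y c +ᶜ Z c) ≗ Σζ^*ᶜ Y +ᶜ Σζ^*ᶜ Z
  Σζ^*ᶜ-+ᶜ Y Z j = begin
    Σζ^*ᶜ (λ c → Y c +ᶜ Z c) j                               ≡⟨ Σζ^*ᶜ-pointwise (λ c → Y c +ᶜ Z c) j ⟩
    Σℤ Fs (λ c → Y c (j ⊖ c) + Z c (j ⊖ c))                  ≡⟨ Σℤ-distrib-+ Fs (λ c → Y c (j ⊖ c)) (λ c → Z c (j ⊖ c)) ⟩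
    Σℤ Fs (λ c → Y c (j ⊖ c)) + Σℤ Fs (λ c → Z c (j ⊖ c))    ≡⟨ sym (cong₂ _+_ (Σζ^*ᶜ-pointwise Y j) (Σζ^*ᶜ-pointwise Z j)) ⟩
    Σζ^*ᶜ Y j + Σζ^*ᶜ Z j                                    ∎
    where open ≡-Reasoning

  Σζ^*ᶜ-cong : ∀ {Y Z} → (∀ c → Y c ≃ Z c) → Σζ^*ᶜ Y ≃ Σζ^*ᶜ Z
  Σζ^*ᶜ-cong {Y} {Z} Y≃Z = Σᶜ-cong Fs (λ c → *ᶜ-congʳ (ζ^ c) (Y≃Z c))

  Σζ^*ᶜ-·1ᶜ : ∀ (r : F → ℤ) → Σζ^*ᶜ (λ c → r c · 1ᶜ) ≗ r
  Σζ^*ᶜ-·1ᶜ r j = begin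
    Σζ^*ᶜ (λ c → r c · 1ᶜ) j          ≡⟨ Σζ^*ᶜ-pointwise (λ c → r c · 1ᶜ) j ⟩
    Σℤ Fs (λ c → r c * 1ᶜ (j ⊖ c))    ≡⟨ Σℤ-cong Fs (λ c → trans (cong (r c *_) (1ᶜ[j⊖c] c)) (ℤP.*-comm (r c) (δF c j))) ⟩
    Σℤ Fs (λ c → δF c j * r c)        ≡⟨ ΣF.Σ-δ j r ⟩
    r j                               ∎
    where
      open ≡-Reasoning
      1ᶜ[j⊖c] : ∀ c → 1ᶜ (j ⊖ c) ≡ δF c j
      1ᶜ[j⊖c] c = trans (ζ^≡δ 0F (j ⊖ c))
                        (𝟙-cong ((j ⊖ c) FinP.≟ 0F) (c FinP.≟ j) (λ e → sym (x⊖y≡0⇒x≡y j c e)) (λ { refl → x⊖x≡0 c }))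

module ScaledIdempotents (p : ℕ) .{{_ : NonZero p}} where
  open GF p hiding (Σℤ)
  open ModularArithmetic p
  open Enumerations p
  open Cyclotomic p

  module _ (Y : F → Cyc) (N : ℤ)
           (Y-real : ∀ c → conj (Y c) ≃ Y c)
           (Y-idem : ∀ c → Y c *ᶜ Y c ≃ N · Y c)
           (Y-sum : Σᶜ Fs Y ≃ N · 1ᶜ) where

    Tr-norm[YcYd] : ∀ c d → Tr ((Y c *ᶜ Y d) *ᶜ conj (Y c *ᶜ Y d)) ≡ (N * N) * Tr (Y c *ᶜ Y d)
    Tr-norm[YcYd] c d = trans (Tr-cong square) (Tr-· (N * N) (Y c *ᶜ Y d))
      where
        open SetoidReasoning ≃-setoid
        square : (Y c *ᶜ Y d) *ᶜ conj (Y c *ᶜ Y d) ≃ (N * N) · (Y c *ᶜ Y d)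
        square = begin
          (Y c *ᶜ Y d) *ᶜ conj (Y c *ᶜ Y d)  ≈⟨ *ᶜ-congʳ (Y c *ᶜ Y d) (≃-trans (≗⇒≃ (conj-*ᶜ (Y c) (Y d))) (*ᶜ-cong (Y-real c) (Y-real d))) ⟩
          (Y c *ᶜ Y d) *ᶜ (Y c *ᶜ Y d)       ≈⟨ *ᶜ-interchange (Y c) (Y d) (Y c) (Y d) ⟩
          (Y c *ᶜ Y c) *ᶜ (Y d *ᶜ Y d)       ≈⟨ *ᶜ-cong (Y-idem c) (Y-idem d) ⟩
          (N · Y c) *ᶜ (N · Y d)             ≈⟨ *ᶜ-·ˡ N (Y c) (N · Y d) ⟩
          N · (Y c *ᶜ (N · Y d))             ≈⟨ ·-congˡ N (≗⇒≃ (*ᶜ-·ʳ N (Y c) (Y d))) ⟩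
          N · (N · (Y c *ᶜ Y d))             ≈⟨ ≗⇒≃ (·-·≗* N N (Y c *ᶜ Y d)) ⟩
          (N * N) · (Y c *ᶜ Y d)             ∎

    ΣTr[YcYd] : ∀ c → Σℤ Fs (λ d → Tr (Y c *ᶜ Y d)) ≡ N * Tr (Y c)
    ΣTr[YcYd] c = trans (sym (Tr-Σᶜ Fs (λ d → Y c *ᶜ Y d))) (trans (Tr-cong Σ≃) (Tr-· N (Y c)))
      where
        open SetoidReasoning ≃-setoid
        Σ≃ : Σᶜ Fs (λ d → Y c *ᶜ Y d) ≃ N · Y c
        Σ≃ = begin
          Σᶜ Fs (λ d → Y c *ᶜ Y d)  ≈⟨ ≃-sym (*ᶜ-Σᶜ (Y c) Fs Y) ⟩
          Y c *ᶜ Σᶜ Fs Y            ≈⟨ *ᶜ-congʳ (Y c) Y-sum ⟩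
          Y c *ᶜ (N · 1ᶜ)           ≈⟨ ≗⇒≃ (*ᶜ-·ʳ N (Y c) 1ᶜ) ⟩
          N · (Y c *ᶜ 1ᶜ)           ≈⟨ ≗⇒≃ (λ j → cong (N *_) (*ᶜ-identityʳ (Y c) j)) ⟩
          N · Y c                   ∎

    ΣTr[YcYd]-off-diagonal : ∀ c → Σℤ Fs (λ d → (+ 1 - δF d c) * Tr (Y c *ᶜ Y d)) ≡ + 0
    ΣTr[YcYd]-off-diagonal c = begin
      Σℤ Fs (λ d → (+ 1 - δF d c) * Tr (Y c *ᶜ Y d)) ≡⟨ solve-for-rest (ΣF.Σ-split c (λ d → Tr (Y c *ᶜ Y d))) ⟩
      Σℤ Fs (λ d → Tr (Y c *ᶜ Y d)) - Tr (Y c *ᶜ Y c) ≡⟨ cong₂ _-_ (ΣTr[YcYd] c) (trans (Tr-cong (Y-idem c)) (Tr-· N (Y c))) ⟩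
      N * Tr (Y c) - N * Tr (Y c)                    ≡⟨ ℤP.+-inverseʳ (N * Tr (Y c)) ⟩
      + 0                                            ∎
      where
        open ≡-Reasoning
        solve-for-rest : ∀ {A B C} → A ≡ B + C → C ≡ A - B
        solve-for-rest {B = B} {C} refl = cancel B C
          where cancel : ∀ b c → c ≡ b + c - b
                cancel = solve-∀

    Y-orthogonal : ∀ c d → d ≢ c → Y c *ᶜ Y d ≃ 0ᶜ
    Y-orthogonal c d d≢c = Tr[a*ᶜconj-a]≡0⇒≃0 (Z d) (begin
      Tr (Z d *ᶜ conj (Z d))                     ≡⟨ sym (ℤP.*-identityˡ _) ⟩
      + 1 * Tr (Z d *ᶜ conj (Z d))               ≡⟨ cong (λ w → w * Tr (Z d *ᶜ conj (Z d))) (sym weight≡1) ⟩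
      weighted d                                 ≡⟨ Σℤ-nonneg-≡0 Fs weighted weighted-nonneg Σweighted≡0 (∈-allFin d) ⟩
      + 0                                        ∎)
      where
        open ≡-Reasoning
        Z : F → Cyc
        Z d = Y c *ᶜ Y d
        weighted : F → ℤ
        weighted d = (+ 1 - δF d c) * Tr (Z d *ᶜ conj (Z d))
        weight≡1 : + 1 - δF d c ≡ + 1
        weight≡1 = cong (λ δ → + 1 - δ) (𝟙-no (d FinP.≟ c) d≢c)
        weighted-nonneg : ∀ d → + 0 ≤ weighted d
        weighted-nonneg d with d FinP.≟ c
        ... | yes _ = ℤP.≤-reflexive (sym (ℤP.*-zeroˡ (Tr (Z d *ᶜ conj (Z d)))))
        ... | no _  = subst (+ 0 ≤_) (sym (ℤP.*-identityˡ _)) (Tr[a*ᶜconj-a]-nonneg (Z d))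
        Σweighted≡0 : Σℤ Fs weighted ≡ + 0
        Σweighted≡0 = begin
          Σℤ Fs weighted                                        ≡⟨ Σℤ-cong Fs (λ d → trans (cong ((+ 1 - δF d c) *_) (Tr-norm[YcYd] c d)) (swap (+ 1 - δF d c) (N * N) (Tr (Z d)))) ⟩
          Σℤ Fs (λ d → (N * N) * ((+ 1 - δF d c) * Tr (Z d)))  ≡⟨ Σℤ-*ˡ Fs (N * N) (λ d → (+ 1 - δF d c) * Tr (Z d)) ⟩
          (N * N) * Σℤ Fs (λ d → (+ 1 - δF d c) * Tr (Z d))    ≡⟨ cong ((N * N) *_) (ΣTr[YcYd]-off-diagonal c) ⟩
          (N * N) * + 0                                         ≡⟨ ℤP.*-zeroʳ (N * N) ⟩
          + 0                                                   ∎
          where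
            swap : ∀ a b c → a * (b * c) ≡ b * (a * c)
            swap = solve-∀

    ζ^cYc*ζ^-dYd : ∀ d → Σᶜ Fs (λ c → (ζ^ c *ᶜ Y c) *ᶜ (ζ^ (⊖ d) *ᶜ Y d)) ≃ N · Y d
    ζ^cYc*ζ^-dYd d = begin
      Σᶜ Fs (λ c → (ζ^ c *ᶜ Y c) *ᶜ (ζ^ (⊖ d) *ᶜ Y d))  ≈⟨ Σᶜ-Fs-single d (λ c → (ζ^ c *ᶜ Y c) *ᶜ (ζ^ (⊖ d) *ᶜ Y d)) off-diagonal≃0 ⟩
      (ζ^ d *ᶜ Y d) *ᶜ (ζ^ (⊖ d) *ᶜ Y d)               ≈⟨ *ᶜ-interchange (ζ^ d) (Y d) (ζ^ (⊖ d)) (Y d) ⟩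
      (ζ^ d *ᶜ ζ^ (⊖ d)) *ᶜ (Y d *ᶜ Y d)               ≈⟨ *ᶜ-cong (≗⇒≃ ζ^d*ζ^-d≗1) (Y-idem d) ⟩
      1ᶜ *ᶜ (N · Y d)                                  ≈⟨ ≗⇒≃ (*ᶜ-identityˡ (N · Y d)) ⟩
      N · Y d                                          ∎
      where
        open SetoidReasoning ≃-setoid
        ζ^d*ζ^-d≗1 : ζ^ d *ᶜ ζ^ (⊖ d) ≗ 1ᶜ
        ζ^d*ζ^-d≗1 k = trans (ζ^-*ᶜ-ζ^ d (⊖ d) k) (cong (λ x → ζ^ x k) (x⊕⊖x≡0 d))
        off-diagonal≃0 : ∀ c → c ≢ d → (ζ^ c *ᶜ Y c) *ᶜ (ζ^ (⊖ d) *ᶜ Y d) ≃ 0ᶜ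
        off-diagonal≃0 c c≢d = begin
          (ζ^ c *ᶜ Y c) *ᶜ (ζ^ (⊖ d) *ᶜ Y d)  ≈⟨ *ᶜ-interchange (ζ^ c) (Y c) (ζ^ (⊖ d)) (Y d) ⟩
          (ζ^ c *ᶜ ζ^ (⊖ d)) *ᶜ (Y c *ᶜ Y d)  ≈⟨ *ᶜ-congʳ (ζ^ c *ᶜ ζ^ (⊖ d)) (≃-trans (≗⇒≃ (*ᶜ-comm (Y c) (Y d))) (Y-orthogonal d c c≢d)) ⟩
          (ζ^ c *ᶜ ζ^ (⊖ d)) *ᶜ 0ᶜ            ≈⟨ ≃-trans (≗⇒≃ (*ᶜ-comm (ζ^ c *ᶜ ζ^ (⊖ d)) 0ᶜ)) (*ᶜ-zeroˡ (ζ^ c *ᶜ ζ^ (⊖ d))) ⟩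
          0ᶜ                                  ∎

    Σζ^*ᶜ-norm : Σζ^*ᶜ Y *ᶜ conj (Σζ^*ᶜ Y) ≃ (N * N) · 1ᶜ
    Σζ^*ᶜ-norm = begin
      W *ᶜ conj W                               ≈⟨ *ᶜ-congʳ W conj-W ⟩
      W *ᶜ Σᶜ Fs (λ d → ζ^ (⊖ d) *ᶜ Y d)        ≈⟨ *ᶜ-Σᶜ W Fs (λ d → ζ^ (⊖ d) *ᶜ Y d) ⟩
      Σᶜ Fs (λ d → W *ᶜ (ζ^ (⊖ d) *ᶜ Y d))      ≈⟨ Σᶜ-cong Fs (λ d → ≃-trans (Σᶜ-*ᶜ Fs (λ c → ζ^ c *ᶜ Y c) (ζ^ (⊖ d) *ᶜ Y d)) (ζ^cYc*ζ^-dYd d)) ⟩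
      Σᶜ Fs (λ d → N · Y d)                     ≈⟨ ≗⇒≃ (Σᶜ-· Fs N Y) ⟩
      N · Σᶜ Fs Y                               ≈⟨ ·-congˡ N Y-sum ⟩
      N · (N · 1ᶜ)                              ≈⟨ ≗⇒≃ (·-·≗* N N 1ᶜ) ⟩
      (N * N) · 1ᶜ                              ∎
      where
        open SetoidReasoning ≃-setoid
        W = Σζ^*ᶜ Y
        conj-W : conj W ≃ Σᶜ Fs (λ d → ζ^ (⊖ d) *ᶜ Y d)
        conj-W = ≃-trans (≗⇒≃ (conj-Σᶜ Fs (λ c → ζ^ c *ᶜ Y c)))
                         (Σᶜ-cong Fs (λ d → ≃-trans (≗⇒≃ (conj-*ᶜ (ζ^ d) (Y d))) (*ᶜ-cong (≗⇒≃ (conj-ζ^ d)) (Y-real d))))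

module Orthogonality (p : ℕ) .{{_ : NonZero p}} (p-prime : Prime p) where
  open GF p hiding (Σℤ)
  open ModularArithmetic p
  open Enumerations p

  coprime-to-p : ∀ {a : F} → a ≢ 0F → Coprime (toℕ a) p
  coprime-to-p {a} a≢0 (d∣a , d∣p) with prime⇒irreducible p-prime d∣p
  ... | inj₁ d≡1  = d≡1
  ... | inj₂ refl = contradiction (ℕDiv.∣⇒≤ {{ℕ.≢-nonZero (toℕ≢0 a≢0)}} d∣a) (ℕP.<⇒≱ (FinP.toℕ<n a))

  ⊗-inverse : ∀ (a : F) → a ≢ 0F → ∃ λ (b : F) → ⟦ a ⟧ * ⟦ b ⟧ ≡ₚ + 1
  ⊗-inverse a a≢0 with coprime-Bézout (coprime-to-p a≢0)
  ... | Bézout.+- x y eq = x mod p , (begin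
    ⟦ a ⟧ * ⟦ x mod p ⟧      ≈⟨ *-cong-≡ₚ (≡ₚ-refl {⟦ a ⟧}) (⟦mod⟧ x) ⟩
    ⟦ a ⟧ * + x              ≡⟨ trans (ℤP.*-comm ⟦ a ⟧ (+ x)) (sym (ℤP.pos-* x (toℕ a))) ⟩
    + (x ℕ.* toℕ a)          ≡⟨ cong +_ (sym eq) ⟩
    + (1 ℕ.+ y ℕ.* p)        ≡⟨ trans (ℤP.pos-+ 1 (y ℕ.* p)) (cong (_+_ (+ 1)) (ℤP.pos-* y p)) ⟩
    + 1 + + y * + p          ≈⟨ +-multiple-≡ₚ (+ 1) (+ y) ⟩
    + 1                      ∎)
    where open SetoidReasoning ≡ₚ-setoid
  ... | Bézout.-+ x y eq = ⊖ (x mod p) , (begin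
    ⟦ a ⟧ * ⟦ ⊖ (x mod p) ⟧  ≈⟨ *-cong-≡ₚ (≡ₚ-refl {⟦ a ⟧}) (≡ₚ-trans (⟦⊖⟧ (x mod p)) (neg-cong-≡ₚ (⟦mod⟧ x))) ⟩
    ⟦ a ⟧ * - + x            ≡⟨ ring ⟦ a ⟧ (+ x) ⟩
    + 1 + - (+ 1 + + x * ⟦ a ⟧) ≡⟨ cong (λ t → + 1 + - t) (trans (cong (_+_ (+ 1)) (sym (ℤP.pos-* x (toℕ a)))) (trans (sym (ℤP.pos-+ 1 (x ℕ.* toℕ a))) (cong +_ eq))) ⟩
    + 1 + - + (y ℕ.* p)      ≡⟨ cong (λ t → + 1 + - t) (ℤP.pos-* y p) ⟩
    + 1 + - (+ y * + p)      ≡⟨ cong (_+_ (+ 1)) (ℤP.neg-distribˡ-* (+ y) (+ p)) ⟩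
    + 1 + - + y * + p        ≈⟨ +-multiple-≡ₚ (+ 1) (- + y) ⟩
    + 1                      ∎)
    where
      open SetoidReasoning ≡ₚ-setoid
      ring : ∀ a x → a * - x ≡ + 1 + - (+ 1 + x * a)
      ring = solve-∀

  module _ {a a⁻¹ : F} (a*a⁻¹≡1 : ⟦ a ⟧ * ⟦ a⁻¹ ⟧ ≡ₚ + 1) (w k : F) where
    open SetoidReasoning ≡ₚ-setoid

    affine-root-unique : ∀ b → (a ⊗ b) ⊕ w ≡ k → b ≡ a⁻¹ ⊗ (k ⊖ w)
    affine-root-unique b root = ⟦⟧-injective (≡ₚ-sym (begin
      ⟦ a⁻¹ ⊗ (k ⊖ w) ⟧                           ≈⟨ ≡ₚ-trans (⟦⊗⟧ a⁻¹ (k ⊖ w)) (*-cong-≡ₚ (≡ₚ-refl {⟦ a⁻¹ ⟧}) (⟦⊖⟧₂ k w)) ⟩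
      ⟦ a⁻¹ ⟧ * (⟦ k ⟧ - ⟦ w ⟧)                   ≈⟨ *-cong-≡ₚ (≡ₚ-refl {⟦ a⁻¹ ⟧}) (-‿cong-≡ₚ ⟦k⟧ (≡ₚ-refl {⟦ w ⟧})) ⟩
      ⟦ a⁻¹ ⟧ * (⟦ a ⟧ * ⟦ b ⟧ + ⟦ w ⟧ - ⟦ w ⟧)   ≡⟨ ring ⟦ a⁻¹ ⟧ ⟦ a ⟧ ⟦ b ⟧ ⟦ w ⟧ ⟩
      (⟦ a ⟧ * ⟦ a⁻¹ ⟧) * ⟦ b ⟧                   ≈⟨ *-cong-≡ₚ a*a⁻¹≡1 (≡ₚ-refl {⟦ b ⟧}) ⟩
      + 1 * ⟦ b ⟧                                 ≡⟨ ℤP.*-identityˡ ⟦ b ⟧ ⟩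
      ⟦ b ⟧                                       ∎))
      where
        ⟦k⟧ : ⟦ k ⟧ ≡ₚ ⟦ a ⟧ * ⟦ b ⟧ + ⟦ w ⟧
        ⟦k⟧ = ≡ₚ-trans (≡⇒≡ₚ (cong ⟦_⟧ (sym root))) (≡ₚ-trans (⟦⊕⟧ (a ⊗ b) w) (+-cong-≡ₚ (⟦⊗⟧ a b) (≡ₚ-refl {⟦ w ⟧})))
        ring : ∀ i a b w → i * (a * b + w - w) ≡ (a * i) * b
        ring = solve-∀

    affine-root : (a ⊗ (a⁻¹ ⊗ (k ⊖ w))) ⊕ w ≡ k
    affine-root = ⟦⟧-injective (begin
      ⟦ (a ⊗ b) ⊕ w ⟧                            ≈⟨ ≡ₚ-trans (⟦⊕⟧ (a ⊗ b) w) (+-cong-≡ₚ (⟦⊗⟧ a b) (≡ₚ-refl {⟦ w ⟧})) ⟩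
      ⟦ a ⟧ * ⟦ b ⟧ + ⟦ w ⟧                      ≈⟨ +-cong-≡ₚ (*-cong-≡ₚ (≡ₚ-refl {⟦ a ⟧}) ⟦b⟧) (≡ₚ-refl {⟦ w ⟧}) ⟩
      ⟦ a ⟧ * (⟦ a⁻¹ ⟧ * (⟦ k ⟧ - ⟦ w ⟧)) + ⟦ w ⟧  ≡⟨ ring ⟦ a ⟧ ⟦ a⁻¹ ⟧ ⟦ k ⟧ ⟦ w ⟧ ⟩
      (⟦ a ⟧ * ⟦ a⁻¹ ⟧) * (⟦ k ⟧ - ⟦ w ⟧) + ⟦ w ⟧ ≈⟨ +-cong-≡ₚ (*-cong-≡ₚ a*a⁻¹≡1 (≡ₚ-refl {⟦ k ⟧ - ⟦ w ⟧})) (≡ₚ-refl {⟦ w ⟧}) ⟩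
      + 1 * (⟦ k ⟧ - ⟦ w ⟧) + ⟦ w ⟧              ≡⟨ cancel ⟦ k ⟧ ⟦ w ⟧ ⟩
      ⟦ k ⟧                                      ∎)
      where
        b = a⁻¹ ⊗ (k ⊖ w)
        ⟦b⟧ : ⟦ b ⟧ ≡ₚ ⟦ a⁻¹ ⟧ * (⟦ k ⟧ - ⟦ w ⟧)
        ⟦b⟧ = ≡ₚ-trans (⟦⊗⟧ a⁻¹ (k ⊖ w)) (*-cong-≡ₚ (≡ₚ-refl {⟦ a⁻¹ ⟧}) (⟦⊖⟧₂ k w))
        ring : ∀ a i k w → a * (i * (k - w)) + w ≡ (a * i) * (k - w) + w
        ring = solve-∀
        cancel : ∀ k w → + 1 * (k - w) + w ≡ k
        cancel = solve-∀

  fibre-unit∷ : ∀ {n} {a : F} (a′ : V n) → a ≢ 0F → ∀ k → fibre (a ∷ a′) k ≡ Σℤ (allVecs n) (λ _ → + 1)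
  fibre-unit∷ {n} {a} a′ a≢0 k with ⊗-inverse a a≢0
  ... | a⁻¹ , a*a⁻¹≡1 = begin
    fibre (a ∷ a′) k                                          ≡⟨ Σℤ-allVecs-suc n (λ d → δF ⟨ a ∷ a′ , d ⟩ k) ⟩
    Σℤ Fs (λ b → Σℤ (allVecs n) (λ d → δF ⟨ a ∷ a′ , b ∷ d ⟩ k)) ≡⟨ Σℤ-swap Fs (allVecs n) (λ b d → δF ⟨ a ∷ a′ , b ∷ d ⟩ k) ⟩
    Σℤ (allVecs n) (λ d → Σℤ Fs (λ b → δF ⟨ a ∷ a′ , b ∷ d ⟩ k)) ≡⟨ Σℤ-cong (allVecs n) (λ d → trans (Σℤ-cong Fs (unique-root d)) (Fs-enumerates _)) ⟩
    Σℤ (allVecs n) (λ _ → + 1)                                ∎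
    where
      open ≡-Reasoning
      unique-root : ∀ d b → δF ⟨ a ∷ a′ , b ∷ d ⟩ k ≡ δF b (a⁻¹ ⊗ (k ⊖ ⟨ a′ , d ⟩))
      unique-root d b = 𝟙-cong (⟨ a ∷ a′ , b ∷ d ⟩ FinP.≟ k) (b FinP.≟ (a⁻¹ ⊗ (k ⊖ ⟨ a′ , d ⟩)))
        (λ e → affine-root-unique {a} {a⁻¹} a*a⁻¹≡1 ⟨ a′ , d ⟩ k b (trans (sym (⟨∷,∷⟩ a a′ b d)) e))
        (λ { refl → trans (⟨∷,∷⟩ a a′ b d) (affine-root {a} {a⁻¹} a*a⁻¹≡1 ⟨ a′ , d ⟩ k) })

  fibre-0∷ : ∀ {n} (a′ : V n) k → fibre (0F ∷ a′) k ≡ Σℤ Fs (λ _ → fibre a′ k)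
  fibre-0∷ {n} a′ k = trans (Σℤ-allVecs-suc n (λ d → δF ⟨ 0F ∷ a′ , d ⟩ k))
    (Σℤ-cong Fs (λ b → Σℤ-cong (allVecs n) (λ d → cong (λ x → δF x k) (trans (⟨∷,∷⟩ 0F a′ b d) (0⊗b⊕w≡w b ⟨ a′ , d ⟩)))))
    where
      0⊗b⊕w≡w : ∀ b w → (0F ⊗ b) ⊕ w ≡ w
      0⊗b⊕w≡w b w = via-ℤ (≡ₚ-trans (⟦⊕⟧ (0F ⊗ b) w) (+-cong-≡ₚ (≡ₚ-trans (⟦⊗⟧ 0F b) (*-cong-≡ₚ ⟦0F⟧ (≡ₚ-refl {⟦ b ⟧}))) (≡ₚ-refl {⟦ w ⟧})))
                          (≡ₚ-refl {⟦ w ⟧}) (ℤP.+-identityˡ ⟦ w ⟧)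

  fibre-constant : ∀ {n} (a : V n) → a ≢ 0ᵥ → ∃ λ t → ∀ k → fibre a k ≡ t
  fibre-constant []       []≢0 = ⊥-elim ([]≢0 refl)
  fibre-constant (a ∷ a′) a∷a′≢0 with a FinP.≟ 0F
  ... | no a≢0    = _ , fibre-unit∷ a′ a≢0
  ... | yes refl with fibre-constant a′ (λ a′≡0 → a∷a′≢0 (cong (0F ∷_) a′≡0))
  ...   | t , fibre≡t = Σℤ Fs (λ _ → t) , λ k → trans (fibre-0∷ a′ k) (Σℤ-cong Fs (λ _ → fibre≡t k))

module CharacterSums (p : ℕ) .{{_ : NonZero p}} {n : ℕ} where
  open GF p hiding (Σℤ)
  open ModularArithmetic p
  open Enumerations p
  open Cyclotomic p

  Vs : List (V n)
  Vs = allVecs n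

  infixl 7 _⋆_
  _⋆_ : (V n → ℤ) → (V n → ℤ) → V n → ℤ
  (g ⋆ h) d = Σℤ Vs (λ z → g z * h (d -ᵥ z))

  χ : V n → (V n → ℤ) → Cyc
  χ a g j = Σℤ Vs (λ u → g u * δF ⟨ a , u ⟩ j)

  module _ (a : V n) where

    χ-*ᶜ : ∀ g b k → (χ a g *ᶜ b) k ≡ Σℤ Vs (λ u → g u * b (k ⊖ ⟨ a , u ⟩))
    χ-*ᶜ g b k = begin
      Σℤ Fs (λ i → χ a g i * b (k ⊖ i))                                ≡⟨ Σℤ-cong Fs (λ i → sym (Σℤ-*ʳ Vs (b (k ⊖ i)) (λ u → g u * δF ⟨ a , u ⟩ i))) ⟩
      Σℤ Fs (λ i → Σℤ Vs (λ u → g u * δF ⟨ a , u ⟩ i * b (k ⊖ i)))   ≡⟨ Σℤ-swap Fs Vs (λ i u → g u * δF ⟨ a , u ⟩ i * b (k ⊖ i)) ⟩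
      Σℤ Vs (λ u → Σℤ Fs (λ i → g u * δF ⟨ a , u ⟩ i * b (k ⊖ i)))   ≡⟨ Σℤ-cong Vs (λ u → trans (Σℤ-cong Fs (λ i → swap (g u) (δF ⟨ a , u ⟩ i) (b (k ⊖ i))))
                                                                                                 (ΣF.Σ-δˡ ⟨ a , u ⟩ (λ i → g u * b (k ⊖ i)))) ⟩
      Σℤ Vs (λ u → g u * b (k ⊖ ⟨ a , u ⟩))                          ∎
      where
        open ≡-Reasoning
        swap : ∀ x y z → x * y * z ≡ y * (x * z)
        swap = solve-∀

    χ-translate : ∀ h z k → Σℤ Vs (λ d → h (d -ᵥ z) * δF ⟨ a , d ⟩ k) ≡ χ a h (k ⊖ ⟨ a , z ⟩)
    χ-translate h z k = begin
      Σℤ Vs (λ d → h (d -ᵥ z) * δF ⟨ a , d ⟩ k)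
        ≡⟨ sym (ΣV.Σ-reindex-involution (_-ᵥ_ z) (x-ᵥ[x-ᵥy]≡y z) (λ d → h (d -ᵥ z) * δF ⟨ a , d ⟩ k)) ⟩
      Σℤ Vs (λ d → h ((z -ᵥ d) -ᵥ z) * δF ⟨ a , z -ᵥ d ⟩ k)
        ≡⟨ Σℤ-cong Vs (λ d → cong₂ (λ x y → h x * δF y k) ([x-ᵥy]-ᵥx≡-ᵥy z d) (⟨x,y-ᵥz⟩ a z d)) ⟩
      Σℤ Vs (λ d → h (-ᵥ d) * δF (⟨ a , z ⟩ ⊖ ⟨ a , d ⟩) k)
        ≡⟨ sym (ΣV.Σ-reindex-involution -ᵥ_ -ᵥ-involutive (λ d → h (-ᵥ d) * δF (⟨ a , z ⟩ ⊖ ⟨ a , d ⟩) k)) ⟩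
      Σℤ Vs (λ d → h (-ᵥ (-ᵥ d)) * δF (⟨ a , z ⟩ ⊖ ⟨ a , -ᵥ d ⟩) k)
        ≡⟨ Σℤ-cong Vs (λ d → cong₂ _*_ (cong h (-ᵥ-involutive d)) (shifted d)) ⟩
      Σℤ Vs (λ d → h d * δF ⟨ a , d ⟩ (k ⊖ ⟨ a , z ⟩)) ∎
      where
        open ≡-Reasoning
        shifted : ∀ d → δF (⟨ a , z ⟩ ⊖ ⟨ a , -ᵥ d ⟩) k ≡ δF ⟨ a , d ⟩ (k ⊖ ⟨ a , z ⟩)
        shifted d = trans (cong (λ y → δF y k) (trans (cong (_⊖_ ⟨ a , z ⟩) (⟨x,-ᵥy⟩ a d)) (x⊖⊖y≡y⊕x ⟨ a , z ⟩ ⟨ a , d ⟩)))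
                          (𝟙-cong ((⟨ a , d ⟩ ⊕ ⟨ a , z ⟩) FinP.≟ k) (⟨ a , d ⟩ FinP.≟ (k ⊖ ⟨ a , z ⟩))
                                  (x⊕y≡z⇒x≡z⊖y ⟨ a , d ⟩ ⟨ a , z ⟩ k) (λ e → trans (cong (_⊕ ⟨ a , z ⟩) e) ([x⊖y]⊕y≡x k ⟨ a , z ⟩)))

    χ-⋆ : ∀ g h → χ a g *ᶜ χ a h ≗ χ a (g ⋆ h)
    χ-⋆ g h k = begin
      (χ a g *ᶜ χ a h) k                                                 ≡⟨ χ-*ᶜ g (χ a h) k ⟩
      Σℤ Vs (λ z → g z * χ a h (k ⊖ ⟨ a , z ⟩))                        ≡⟨ Σℤ-cong Vs (λ z → cong (g z *_) (sym (χ-translate h z k))) ⟩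
      Σℤ Vs (λ z → g z * Σℤ Vs (λ d → h (d -ᵥ z) * δF ⟨ a , d ⟩ k))  ≡⟨ Σℤ-cong Vs (λ z → sym (Σℤ-*ˡ Vs (g z) _)) ⟩
      Σℤ Vs (λ z → Σℤ Vs (λ d → g z * (h (d -ᵥ z) * δF ⟨ a , d ⟩ k)))  ≡⟨ Σℤ-swap Vs Vs (λ z d → g z * (h (d -ᵥ z) * δF ⟨ a , d ⟩ k)) ⟩
      Σℤ Vs (λ d → Σℤ Vs (λ z → g z * (h (d -ᵥ z) * δF ⟨ a , d ⟩ k)))  ≡⟨ Σℤ-cong Vs (λ d → trans (Σℤ-cong Vs (λ z → sym (ℤP.*-assoc (g z) _ _)))
                                                                                                  (Σℤ-*ʳ Vs (δF ⟨ a , d ⟩ k) (λ z → g z * h (d -ᵥ z)))) ⟩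
      χ a (g ⋆ h) k                                                    ∎
      where open ≡-Reasoning

    χ-cong : ∀ {g h} → g ≗ h → χ a g ≗ χ a h
    χ-cong g≗h j = Σℤ-cong Vs (λ u → cong (_* δF ⟨ a , u ⟩ j) (g≗h u))

    χ-linear₃ : ∀ α β γ g h k → χ a (λ d → α * g d + β * h d + γ * k d) ≗ λ j → α * χ a g j + β * χ a h j + γ * χ a k j
    χ-linear₃ α β γ g h k j = trans (Σℤ-cong Vs (λ d → distrib α β γ (g d) (h d) (k d) (δF ⟨ a , d ⟩ j)))
      (Σℤ-linear₃ Vs α β γ (λ d → g d * δF ⟨ a , d ⟩ j) (λ d → h d * δF ⟨ a , d ⟩ j) (λ d → k d * δF ⟨ a , d ⟩ j))
      where distrib : ∀ α β γ x y z δ → (α * x + β * y + γ * z) * δ ≡ α * (x * δ) + β * (y * δ) + γ * (z * δ)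
            distrib = solve-∀

    χ-Σ : ∀ (g : F → V n → ℤ) → Σᶜ Fs (λ c → χ a (g c)) ≗ χ a (λ d → Σℤ Fs (λ c → g c d))
    χ-Σ g j = begin
      Σᶜ Fs (λ c → χ a (g c)) j                        ≡⟨ Σᶜ-pointwise Fs (λ c → χ a (g c)) j ⟩
      Σℤ Fs (λ c → Σℤ Vs (λ d → g c d * δF ⟨ a , d ⟩ j)) ≡⟨ Σℤ-swap Fs Vs (λ c d → g c d * δF ⟨ a , d ⟩ j) ⟩
      Σℤ Vs (λ d → Σℤ Fs (λ c → g c d * δF ⟨ a , d ⟩ j)) ≡⟨ Σℤ-cong Vs (λ d → Σℤ-*ʳ Fs (δF ⟨ a , d ⟩ j) (λ c → g c d)) ⟩
      χ a (λ d → Σℤ Fs (λ c → g c d)) j                ∎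
      where open ≡-Reasoning

    δ⟨a,0⟩≗1ᶜ : (λ j → δF ⟨ a , 0ᵥ ⟩ j) ≗ 1ᶜ
    δ⟨a,0⟩≗1ᶜ j = begin
      δF ⟨ a , 0ᵥ ⟩ j  ≡⟨ cong (λ x → δF x j) (⟨x,0⟩≡0 a) ⟩
      δF 0F j          ≡⟨ EnumF.δ-sym 0F j ⟩
      δF j 0F          ≡⟨ sym (ζ^≡δ 0F j) ⟩
      1ᶜ j             ∎
      where open ≡-Reasoning

    χ-δ0 : χ a (λ d → δV d 0ᵥ) ≗ 1ᶜ
    χ-δ0 j = trans (ΣV.Σ-δ 0ᵥ (λ d → δF ⟨ a , d ⟩ j)) (δ⟨a,0⟩≗1ᶜ j)

    χ-1 : χ a (λ _ → + 1) ≗ fibre a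
    χ-1 j = Σℤ-cong Vs (λ d → ℤP.*-identityˡ (δF ⟨ a , d ⟩ j))

    conj-χ-even : ∀ g → (∀ u → g (-ᵥ u) ≡ g u) → conj (χ a g) ≗ χ a g
    conj-χ-even g g-even j = begin
      Σℤ Vs (λ u → g u * δF ⟨ a , u ⟩ (⊖ j))                ≡⟨ sym (ΣV.Σ-reindex-involution -ᵥ_ -ᵥ-involutive (λ u → g u * δF ⟨ a , u ⟩ (⊖ j))) ⟩
      Σℤ Vs (λ u → g (-ᵥ u) * δF ⟨ a , -ᵥ u ⟩ (⊖ j))        ≡⟨ Σℤ-cong Vs (λ u → cong₂ _*_ (g-even u) (trans (cong (λ x → δF x (⊖ j)) (⟨x,-ᵥy⟩ a u)) (negate u))) ⟩
      Σℤ Vs (λ u → g u * δF ⟨ a , u ⟩ j)                    ∎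
      where
        open ≡-Reasoning
        negate : ∀ u → δF (⊖ ⟨ a , u ⟩) (⊖ j) ≡ δF ⟨ a , u ⟩ j
        negate u = 𝟙-cong ((⊖ ⟨ a , u ⟩) FinP.≟ (⊖ j)) (⟨ a , u ⟩ FinP.≟ j)
                          (λ e → trans (sym (⊖-involutive _)) (trans (cong ⊖_ e) (⊖-involutive j))) (cong (λ x → ⊖ x))

    χ-at-0ᵥ : a ≡ 0ᵥ → ∀ g → χ a g ≗ Σℤ Vs g · 1ᶜ
    χ-at-0ᵥ refl g j = begin
      Σℤ Vs (λ u → g u * δF ⟨ 0ᵥ , u ⟩ j)  ≡⟨ Σℤ-cong Vs (λ u → cong (λ x → g u * δF x j) (⟨0,y⟩≡0 u)) ⟩
      Σℤ Vs (λ u → g u * δF 0F j)          ≡⟨ Σℤ-*ʳ Vs (δF 0F j) g ⟩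
      Σℤ Vs g * δF 0F j                    ≡⟨ cong (Σℤ Vs g *_) (trans (EnumF.δ-sym 0F j) (sym (ζ^≡δ 0F j))) ⟩
      Σℤ Vs g * 1ᶜ j                       ∎
      where open ≡-Reasoning

module LevelSets (p : ℕ) .{{_ : NonZero p}} {n : ℕ} (f : GF.V p n → GF.F p) where
  open GF p hiding (Σℤ)
  open ModularArithmetic p
  open Enumerations p
  open CharacterSums p {n}

  -- D c = f⁻¹(c) ∖ {0}, so D 0F is the paper's D_p.
  D : F → V n → Set
  D c u = u ≢ 0ᵥ × f u ≡ c

  D? : ∀ c u → Dec (D c u)
  D? c u = ¬? (u ≟ᵥ 0ᵥ) ×-dec (f u FinP.≟ c)

  𝟙D : F → V n → ℤ
  𝟙D c u = 𝟙 (D? c u)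

  𝟙D-0ᵥ : ∀ c → 𝟙D c 0ᵥ ≡ + 0
  𝟙D-0ᵥ c = 𝟙-no (D? c 0ᵥ) (λ (0≢0 , _) → 0≢0 refl)

  𝟙D≡ : ∀ c u → 𝟙D c u ≡ (+ 1 - δV u 0ᵥ) * δF (f u) c
  𝟙D≡ c u = trans (𝟙-× (¬? (u ≟ᵥ 0ᵥ)) (f u FinP.≟ c) (D? c u) proj₁ proj₂ _,_)
                  (cong (_* δF (f u) c) (𝟙-¬ (u ≟ᵥ 0ᵥ)))

  Σ𝟙D : ∀ u → Σℤ Fs (λ c → 𝟙D c u) ≡ + 1 - δV u 0ᵥ
  Σ𝟙D u = begin
    Σℤ Fs (λ c → 𝟙D c u)                          ≡⟨ Σℤ-cong Fs (λ c → 𝟙D≡ c u) ⟩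
    Σℤ Fs (λ c → (+ 1 - δV u 0ᵥ) * δF (f u) c)    ≡⟨ Σℤ-*ˡ Fs (+ 1 - δV u 0ᵥ) (δF (f u)) ⟩
    (+ 1 - δV u 0ᵥ) * Σℤ Fs (δF (f u))            ≡⟨ cong ((+ 1 - δV u 0ᵥ) *_) (trans (Σℤ-cong Fs (EnumF.δ-sym (f u))) (Fs-enumerates (f u))) ⟩
    (+ 1 - δV u 0ᵥ) * + 1                         ≡⟨ ℤP.*-identityʳ _ ⟩
    + 1 - δV u 0ᵥ                                 ∎
    where open ≡-Reasoning

  module _ (f-even : Even f) where

    𝟙D-even : ∀ c u → 𝟙D c (-ᵥ u) ≡ 𝟙D c u
    𝟙D-even c u = 𝟙-cong (D? c (-ᵥ u)) (D? c u)
      (λ (-u≢0 , f-u≡c) → (λ u≡0 → -u≢0 (trans (cong -ᵥ_ u≡0) -ᵥ0≡0)) , trans (sym (f-even u)) f-u≡c)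
      (λ (u≢0 , fu≡c) → (λ -u≡0 → u≢0 (-ᵥx≡0⇒x≡0 u -u≡0)) , trans (f-even u) fu≡c)

    module Regularity (c : F) (i : ℕ) (i≡c : i mod p ≡ c) {ν K L M : ℤ}
             (srg : StronglyRegular (Adj f i) (adj? f i) ν K L M) where

      Adj-0ᵥ⇔D : ∀ z → 𝟙 (adj? f i 0ᵥ z) ≡ 𝟙D c z
      Adj-0ᵥ⇔D z = 𝟙-cong (adj? f i 0ᵥ z) (D? c z)
        (λ (0≢z , f[0-z]≡i) → (0≢z ∘ sym) , trans (sym f[0-z]≡fz) (trans f[0-z]≡i i≡c))
        (λ (z≢0 , fz≡c) → (z≢0 ∘ sym) , trans f[0-z]≡fz (trans fz≡c (sym i≡c)))
        where f[0-z]≡fz = trans (cong f (0-ᵥx≡-ᵥx z)) (f-even z)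

      Adj⇔D : ∀ d z → 𝟙 (adj? f i d z) ≡ 𝟙D c (d -ᵥ z)
      Adj⇔D d z = 𝟙-cong (adj? f i d z) (D? c (d -ᵥ z))
        (λ (d≢z , f[d-z]≡i) → (d≢z ∘ x-ᵥy≡0⇒x≡y d z) , trans f[d-z]≡i i≡c)
        (λ (d-z≢0 , f[d-z]≡c) → (λ { refl → d-z≢0 (x-ᵥx≡0 d) }) , trans f[d-z]≡c (sym i≡c))

      common≡𝟙D⋆𝟙D : ∀ d → + common (Adj f i) (adj? f i) 0ᵥ d ≡ (𝟙D c ⋆ 𝟙D c) d
      common≡𝟙D⋆𝟙D d = trans (length-filter≡Σ𝟙 (λ z → adj? f i 0ᵥ z ×-dec adj? f i d z) Vs)
        (Σℤ-cong Vs (λ z → trans (𝟙-× (adj? f i 0ᵥ z) (adj? f i d z) (adj? f i 0ᵥ z ×-dec adj? f i d z) proj₁ proj₂ _,_)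
                                 (cong₂ _*_ (Adj-0ᵥ⇔D z) (Adj⇔D d z))))

      degree≡Σ𝟙D : + degree (Adj f i) (adj? f i) 0ᵥ ≡ Σℤ Vs (𝟙D c)
      degree≡Σ𝟙D = trans (length-filter≡Σ𝟙 (adj? f i 0ᵥ) Vs) (Σℤ-cong Vs Adj-0ᵥ⇔D)

      Σ𝟙D≡K : Σℤ Vs (𝟙D c) ≡ K
      Σ𝟙D≡K = trans (sym degree≡Σ𝟙D) (proj₁ (proj₂ srg) 0ᵥ)

      common-self≡degree : + common (Adj f i) (adj? f i) 0ᵥ 0ᵥ ≡ + degree (Adj f i) (adj? f i) 0ᵥ
      common-self≡degree = trans (length-filter≡Σ𝟙 (λ z → adj? f i 0ᵥ z ×-dec adj? f i 0ᵥ z) Vs)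
        (trans (Σℤ-cong Vs (λ z → 𝟙-cong (adj? f i 0ᵥ z ×-dec adj? f i 0ᵥ z) (adj? f i 0ᵥ z) proj₁ (λ e → e , e)))
               (sym (length-filter≡Σ𝟙 (adj? f i 0ᵥ) Vs)))

      𝟙D⋆𝟙D≡ : ∀ d → (𝟙D c ⋆ 𝟙D c) d ≡ (K - M) * δV d 0ᵥ + (L - M) * 𝟙D c d + M * + 1
      𝟙D⋆𝟙D≡ d = by-cases d (d ≟ᵥ 0ᵥ) (adj? f i 0ᵥ d)
       where
        by-cases : ∀ d → Dec (d ≡ 0ᵥ) → Dec (Adj f i 0ᵥ d) → (𝟙D c ⋆ 𝟙D c) d ≡ (K - M) * δV d 0ᵥ + (L - M) * 𝟙D c d + M * + 1
        by-cases d (yes refl) _ = begin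
          (𝟙D c ⋆ 𝟙D c) 0ᵥ                         ≡⟨ sym (common≡𝟙D⋆𝟙D 0ᵥ) ⟩
          + common (Adj f i) (adj? f i) 0ᵥ 0ᵥ      ≡⟨ trans common-self≡degree (proj₁ (proj₂ srg) 0ᵥ) ⟩
          K                                        ≡⟨ ring K L M ⟩
          (K - M) * + 1 + (L - M) * + 0 + M * + 1  ≡⟨ cong₂ (λ x y → (K - M) * x + (L - M) * y + M * + 1) (sym (EnumV.δ-refl {n} 0ᵥ)) (sym (𝟙D-0ᵥ c)) ⟩
          (K - M) * δV (0ᵥ {n}) 0ᵥ + (L - M) * 𝟙D c 0ᵥ + M * + 1 ∎
          where
            open ≡-Reasoning
            ring : ∀ K L M → K ≡ (K - M) * + 1 + (L - M) * + 0 + M * + 1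
            ring = solve-∀
        by-cases d (no d≢0) (yes adj) = begin
          (𝟙D c ⋆ 𝟙D c) d                          ≡⟨ sym (common≡𝟙D⋆𝟙D d) ⟩
          + common (Adj f i) (adj? f i) 0ᵥ d       ≡⟨ proj₁ (proj₂ (proj₂ srg)) 0ᵥ d adj ⟩
          L                                        ≡⟨ ring K L M ⟩
          (K - M) * + 0 + (L - M) * + 1 + M * + 1  ≡⟨ cong₂ (λ x y → (K - M) * x + (L - M) * y + M * + 1) (sym (𝟙-no (d ≟ᵥ 0ᵥ) d≢0))
                                                            (trans (sym (𝟙-yes (adj? f i 0ᵥ d) adj)) (Adj-0ᵥ⇔D d)) ⟩
          (K - M) * δV d 0ᵥ + (L - M) * 𝟙D c d + M * + 1 ∎
          where
            open ≡-Reasoning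
            ring : ∀ K L M → L ≡ (K - M) * + 0 + (L - M) * + 1 + M * + 1
            ring = solve-∀
        by-cases d (no d≢0) (no ¬adj) = begin
          (𝟙D c ⋆ 𝟙D c) d                          ≡⟨ sym (common≡𝟙D⋆𝟙D d) ⟩
          + common (Adj f i) (adj? f i) 0ᵥ d       ≡⟨ proj₂ (proj₂ (proj₂ srg)) 0ᵥ d (d≢0 ∘ sym) ¬adj ⟩
          M                                        ≡⟨ ring K L M ⟩
          (K - M) * + 0 + (L - M) * + 0 + M * + 1  ≡⟨ cong₂ (λ x y → (K - M) * x + (L - M) * y + M * + 1) (sym (𝟙-no (d ≟ᵥ 0ᵥ) d≢0))
                                                            (trans (sym (𝟙-no (adj? f i 0ᵥ d) ¬adj)) (Adj-0ᵥ⇔D d)) ⟩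
          (K - M) * δV d 0ᵥ + (L - M) * 𝟙D c d + M * + 1 ∎
          where
            open ≡-Reasoning
            ring : ∀ K L M → M ≡ (K - M) * + 0 + (L - M) * + 0 + M * + 1
            ring = solve-∀

module WalshViaLevelSets (p : ℕ) .{{_ : NonZero p}} {n : ℕ} (f : GF.V p n → GF.F p)
                         (f-even : GF.Even p f) (f0 : f (GF.0ᵥ p) ≡ GF.0F p) (a : GF.V p n) where
  open GF p hiding (Σℤ)
  open ModularArithmetic p
  open Enumerations p
  open Cyclotomic p
  open CharacterSums p {n}
  open LevelSets p f

  χD : F → Cyc
  χD c = χ a (𝟙D c)

  χD-real : ∀ c → conj (χD c) ≗ χD c
  χD-real c = conj-χ-even a (𝟙D c) (𝟙D-even f-even c)

  Walsh≠0 : Cyc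
  Walsh≠0 j = Σℤ Vs (λ y → (+ 1 - δV y 0ᵥ) * δF ⟨ a , y ⟩ (f y ⊖ j))

  Walsh≗1+Walsh≠0 : Walsh f a ≗ 1ᶜ +ᶜ Walsh≠0
  Walsh≗1+Walsh≠0 j = begin
    Walsh f a j                                                    ≡⟨ Σᶜ-pointwise Vs (λ y → ζ^ (f y ⊖ ⟨ a , y ⟩)) j ⟩
    Σℤ Vs (λ y → ζ^ (f y ⊖ ⟨ a , y ⟩) j)                           ≡⟨ Σℤ-cong Vs (λ y → ζ^≡δ (f y ⊖ ⟨ a , y ⟩) j) ⟩
    Σℤ Vs (λ y → δF j (f y ⊖ ⟨ a , y ⟩))                           ≡⟨ ΣV.Σ-split 0ᵥ (λ y → δF j (f y ⊖ ⟨ a , y ⟩)) ⟩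
    δF j (f 0ᵥ ⊖ ⟨ a , 0ᵥ ⟩) + Σℤ Vs (λ y → (+ 1 - δV y 0ᵥ) * δF j (f y ⊖ ⟨ a , y ⟩))
      ≡⟨ cong₂ _+_ y=0 (Σℤ-cong Vs (λ y → cong ((+ 1 - δV y 0ᵥ) *_) (solve-for-⟨a,y⟩ y))) ⟩
    1ᶜ j + Walsh≠0 j                                               ∎
    where
      open ≡-Reasoning
      y=0 : δF j (f 0ᵥ ⊖ ⟨ a , 0ᵥ ⟩) ≡ 1ᶜ j
      y=0 = trans (cong (δF j) (trans (cong₂ _⊖_ f0 (⟨x,0⟩≡0 a)) (x⊖x≡0 0F))) (sym (ζ^≡δ 0F j))
      solve-for-⟨a,y⟩ : ∀ y → δF j (f y ⊖ ⟨ a , y ⟩) ≡ δF ⟨ a , y ⟩ (f y ⊖ j)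
      solve-for-⟨a,y⟩ y = 𝟙-cong (j FinP.≟ (f y ⊖ ⟨ a , y ⟩)) (⟨ a , y ⟩ FinP.≟ (f y ⊖ j))
        (λ e → trans (sym (x⊖[x⊖y]≡y (f y) ⟨ a , y ⟩)) (cong (_⊖_ (f y)) (sym e)))
        (λ e → trans (sym (x⊖[x⊖y]≡y (f y) j)) (cong (_⊖_ (f y)) (sym e)))

  Σζ^*ᶜχD≗Walsh≠0 : Σζ^*ᶜ χD ≗ Walsh≠0
  Σζ^*ᶜχD≗Walsh≠0 j = begin
    Σζ^*ᶜ χD j                                                        ≡⟨ Σζ^*ᶜ-pointwise χD j ⟩
    Σℤ Fs (λ c → χD c (j ⊖ c))                                        ≡⟨ Σℤ-cong Fs (λ c → trans (sym (χD-real c (j ⊖ c))) (cong (χD c) (⊖[x⊖y]≡y⊖x j c))) ⟩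
    Σℤ Fs (λ c → Σℤ Vs (λ u → 𝟙D c u * δF ⟨ a , u ⟩ (c ⊖ j)))        ≡⟨ Σℤ-swap Fs Vs (λ c u → 𝟙D c u * δF ⟨ a , u ⟩ (c ⊖ j)) ⟩
    Σℤ Vs (λ u → Σℤ Fs (λ c → 𝟙D c u * δF ⟨ a , u ⟩ (c ⊖ j)))        ≡⟨ Σℤ-cong Vs (λ u → trans (Σℤ-cong Fs (λ c → trans (cong (_* δF ⟨ a , u ⟩ (c ⊖ j)) (𝟙D≡ c u))
                                                                                                                 (swap (+ 1 - δV u 0ᵥ) (δF (f u) c) _)))
                                                                                             (ΣF.Σ-δˡ (f u) (λ c → (+ 1 - δV u 0ᵥ) * δF ⟨ a , u ⟩ (c ⊖ j)))) ⟩
    Walsh≠0 j                                                         ∎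
    where
      open ≡-Reasoning
      swap : ∀ x y z → x * y * z ≡ y * (x * z)
      swap = solve-∀

  ΣχD≗fibre-1 : Σᶜ Fs χD ≗ λ j → fibre a j - 1ᶜ j
  ΣχD≗fibre-1 j = begin
    Σᶜ Fs χD j                                          ≡⟨ χ-Σ a 𝟙D j ⟩
    χ a (λ d → Σℤ Fs (λ c → 𝟙D c d)) j                  ≡⟨ Σℤ-cong Vs (λ d → cong (_* δF ⟨ a , d ⟩ j) (Σ𝟙D d)) ⟩
    Σℤ Vs (λ d → (+ 1 - δV d 0ᵥ) * δF ⟨ a , d ⟩ j)      ≡⟨ solve-for-rest (ΣV.Σ-split 0ᵥ (λ d → δF ⟨ a , d ⟩ j)) ⟩
    fibre a j - δF ⟨ a , 0ᵥ ⟩ j                          ≡⟨ cong (_-_ (fibre a j)) (δ⟨a,0⟩≗1ᶜ a j) ⟩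
    fibre a j - 1ᶜ j                                    ∎
    where
      open ≡-Reasoning
      solve-for-rest : ∀ {A B C} → A ≡ B + C → C ≡ A - B
      solve-for-rest {B = B} {C} refl = cancel B C
        where cancel : ∀ b c → c ≡ b + c - b
              cancel = solve-∀

  module _ (r₀ : ℤ) (r : F → ℤ) (r≡ : ∀ c → r c ≡ r₀ + δF c 0F) where

    Y : F → Cyc
    Y c = χD c +ᶜ (r c · 1ᶜ)

    Y-real : ∀ c → conj (Y c) ≃ Y c
    Y-real c = ≗⇒≃ (λ j → cong₂ _+_ (χD-real c j) (cong (r c *_) (conj-1ᶜ j)))

    Walsh≃Σζ^*ᶜY : Walsh f a ≃ Σζ^*ᶜ Y
    Walsh≃Σζ^*ᶜY = mk≃ (- r₀) (λ j → begin
      Walsh f a j - Σζ^*ᶜ Y j                    ≡⟨ cong₂ _-_ (Walsh≗1+Walsh≠0 j) (Σζ^*ᶜY≗ j) ⟩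
      1ᶜ j + Walsh≠0 j - (Walsh≠0 j + r j)       ≡⟨ cong (λ x → 1ᶜ j + Walsh≠0 j - (Walsh≠0 j + x)) (trans (r≡ j) (cong (_+_ r₀) (sym (ζ^≡δ 0F j)))) ⟩
      1ᶜ j + Walsh≠0 j - (Walsh≠0 j + (r₀ + 1ᶜ j)) ≡⟨ cancel (1ᶜ j) (Walsh≠0 j) r₀ ⟩
      - r₀                                       ∎)
      where
        open ≡-Reasoning
        Σζ^*ᶜY≗ : ∀ j → Σζ^*ᶜ Y j ≡ Walsh≠0 j + r j
        Σζ^*ᶜY≗ j = trans (Σζ^*ᶜ-+ᶜ χD (λ c → r c · 1ᶜ) j) (cong₂ _+_ (Σζ^*ᶜχD≗Walsh≠0 j) (Σζ^*ᶜ-·1ᶜ r j))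
        cancel : ∀ o w r → o + w - (w + (r + o)) ≡ - r
        cancel = solve-∀

    module _ (N : ℤ) (p*r₀≡N : + p * r₀ ≡ N) {t : ℤ} (fibre≡t : ∀ k → fibre a k ≡ t) where

      Y-sum : Σᶜ Fs Y ≃ N · 1ᶜ
      Y-sum = mk≃ t (λ k → begin
        Σᶜ Fs Y k - N * 1ᶜ k                                       ≡⟨ cong (_- N * 1ᶜ k) (trans (Σᶜ-pointwise Fs Y k) (Σℤ-distrib-+ Fs (λ c → χD c k) (λ c → r c * 1ᶜ k))) ⟩
        Σℤ Fs (λ c → χD c k) + Σℤ Fs (λ c → r c * 1ᶜ k) - N * 1ᶜ k  ≡⟨ cong₂ (λ x y → x + y - N * 1ᶜ k) (trans (sym (Σᶜ-pointwise Fs χD k)) (ΣχD≗fibre-1 k)) (Σℤ-*ʳ Fs (1ᶜ k) r) ⟩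
        fibre a k - 1ᶜ k + Σℤ Fs r * 1ᶜ k - N * 1ᶜ k                ≡⟨ cong₂ (λ x y → x - 1ᶜ k + y * 1ᶜ k - N * 1ᶜ k) (fibre≡t k) Σr≡N+1 ⟩
        t - 1ᶜ k + (N + + 1) * 1ᶜ k - N * 1ᶜ k                      ≡⟨ cancel t (1ᶜ k) N ⟩
        t                                                          ∎)
        where
          open ≡-Reasoning
          cancel : ∀ t o N → t - o + (N + + 1) * o - N * o ≡ t
          cancel = solve-∀
          Σr≡N+1 : Σℤ Fs r ≡ N + + 1
          Σr≡N+1 = trans (Σℤ-cong Fs r≡) (trans (Σℤ-distrib-+ Fs (λ _ → r₀) (λ c → δF c 0F))
                         (cong₂ _+_ (trans (Σℤ-Fs-const r₀) p*r₀≡N) (Fs-enumerates 0F)))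

      module _ (𝟙D⋆𝟙D≡ : ∀ c d → (𝟙D c ⋆ 𝟙D c) d ≡ ((N - + 1) * r c - (r c * r c - r c)) * δV d 0ᵥ
                                                   + ((N + r c * r c - + 3 * r c) - (r c * r c - r c)) * 𝟙D c d
                                                   + (r c * r c - r c) * + 1) where

        χD²≗ : ∀ c k → (χD c *ᶜ χD c) k ≡ ((N - + 1) * r c - (r c * r c - r c)) * 1ᶜ k
                                            + ((N + r c * r c - + 3 * r c) - (r c * r c - r c)) * χD c k
                                            + (r c * r c - r c) * t
        χD²≗ c k = begin
          (χD c *ᶜ χD c) k                                ≡⟨ χ-⋆ a (𝟙D c) (𝟙D c) k ⟩
          χ a (𝟙D c ⋆ 𝟙D c) k                             ≡⟨ χ-cong a (𝟙D⋆𝟙D≡ c) k ⟩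
          χ a (λ d → α * δV d 0ᵥ + β * 𝟙D c d + γ * + 1) k ≡⟨ χ-linear₃ a α β γ (λ d → δV d 0ᵥ) (𝟙D c) (λ _ → + 1) k ⟩
          α * χ a (λ d → δV d 0ᵥ) k + β * χD c k + γ * χ a (λ _ → + 1) k
            ≡⟨ cong₂ (λ x y → α * x + β * χD c k + γ * y) (χ-δ0 a k) (trans (χ-1 a k) (fibre≡t k)) ⟩
          α * 1ᶜ k + β * χD c k + γ * t                    ∎
          where
            open ≡-Reasoning
            α = (N - + 1) * r c - (r c * r c - r c)
            β = (N + r c * r c - + 3 * r c) - (r c * r c - r c)
            γ = r c * r c - r c

        Y²≗ : ∀ c k → (Y c *ᶜ Y c) k ≡ (χD c *ᶜ χD c) k + r c * χD c k + r c * Y c k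
        Y²≗ c k = begin
          (Y c *ᶜ Y c) k                                           ≡⟨ *ᶜ-distribˡ-+ᶜ (Y c) (χD c) (r c · 1ᶜ) k ⟩
          (Y c *ᶜ χD c) k + (Y c *ᶜ (r c · 1ᶜ)) k                  ≡⟨ cong₂ _+_ (trans (*ᶜ-comm (Y c) (χD c) k) (*ᶜ-distribˡ-+ᶜ (χD c) (χD c) (r c · 1ᶜ) k))
                                                                                (*ᶜ-·1ᶜ (r c) (Y c) k) ⟩
          (χD c *ᶜ χD c) k + (χD c *ᶜ (r c · 1ᶜ)) k + r c * Y c k  ≡⟨ cong (λ x → (χD c *ᶜ χD c) k + x + r c * Y c k) (*ᶜ-·1ᶜ (r c) (χD c) k) ⟩
          (χD c *ᶜ χD c) k + r c * χD c k + r c * Y c k            ∎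
          where open ≡-Reasoning

        Y-idem : ∀ c → Y c *ᶜ Y c ≃ N · Y c
        Y-idem c = mk≃ ((r c * r c - r c) * t) (λ k → begin
          (Y c *ᶜ Y c) k - N * Y c k
            ≡⟨ cong (_- N * Y c k) (trans (Y²≗ c k) (cong (λ x → x + r c * χD c k + r c * Y c k) (χD²≗ c k))) ⟩
          ((N - + 1) * r c - (r c * r c - r c)) * 1ᶜ k + ((N + r c * r c - + 3 * r c) - (r c * r c - r c)) * χD c k
            + (r c * r c - r c) * t + r c * χD c k + r c * (χD c k + r c * 1ᶜ k) - N * (χD c k + r c * 1ᶜ k)
            ≡⟨ Latin-square-identity N (r c) (1ᶜ k) (χD c k) t ⟩
          (r c * r c - r c) * t ∎)
          where
            open ≡-Reasoning
            Latin-square-identity : ∀ N r o x t →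
              ((N - + 1) * r - (r * r - r)) * o + ((N + r * r - + 3 * r) - (r * r - r)) * x
                + (r * r - r) * t + r * x + r * (x + r * o) - N * (x + r * o) ≡ (r * r - r) * t
            Latin-square-identity = solve-∀

module WalshNormFromSRG (p : ℕ) .{{_ : NonZero p}} (p-prime : Prime p) {n : ℕ} (f : GF.V p n → GF.F p)
                        (f-even : GF.Even p f) (f0 : f (GF.0ᵥ p) ≡ GF.0F p)
                        (N r₀ : ℤ) (r : GF.F p → ℤ)
                        (r≡ : ∀ c → r c ≡ r₀ + Enumerations.δF p c (GF.0F p)) (p*r₀≡N : + p * r₀ ≡ N)
                        (index : GF.F p → ℕ) (index-mod : ∀ c → index c mod p ≡ c)
                        (srg : ∀ c → GF.StronglyRegular p (GF.Adj p f (index c)) (GF.adj? p f (index c))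
                                       (N * N) ((N - + 1) * r c) (N + r c * r c - + 3 * r c) (r c * r c - r c)) where
  open GF p hiding (Σℤ)
  open Enumerations p
  open Cyclotomic p
  open CharacterSums p {n}
  open LevelSets p f
  open Orthogonality p p-prime
  open ScaledIdempotents p

  module _ (c : F) where
    open Regularity f-even c (index c) (index-mod c) (srg c) public

  Walsh-at-0 : Walsh f 0ᵥ ≃ N · 1ᶜ
  Walsh-at-0 = begin
    Walsh f 0ᵥ                                          ≈⟨ ≗⇒≃ (λ j → trans (Walsh≗1+Walsh≠0 j) (cong (_+_ (1ᶜ j)) (sym (Σζ^*ᶜχD≗Walsh≠0 j)))) ⟩
    1ᶜ +ᶜ Σζ^*ᶜ χD                                      ≈⟨ +ᶜ-cong (≃-refl {1ᶜ}) (Σζ^*ᶜ-cong (λ c → ≗⇒≃ (χD≗ c))) ⟩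
    1ᶜ +ᶜ Σζ^*ᶜ (λ c → ((N - + 1) * r c) · 1ᶜ)          ≈⟨ +ᶜ-cong (≃-refl {1ᶜ}) (≗⇒≃ (Σζ^*ᶜ-·1ᶜ (λ c → (N - + 1) * r c))) ⟩
    1ᶜ +ᶜ (λ c → (N - + 1) * r c)                       ≈⟨ mk≃ ((N - + 1) * r₀) collect ⟩
    N · 1ᶜ                                              ∎
    where
      open SetoidReasoning ≃-setoid
      open WalshViaLevelSets p f f-even f0 0ᵥ
      χD≗ : ∀ c → χD c ≗ ((N - + 1) * r c) · 1ᶜ
      χD≗ c j = trans (χ-at-0ᵥ 0ᵥ refl (𝟙D c) j) (cong (_* 1ᶜ j) (Σ𝟙D≡K c))
      collect : ∀ j → 1ᶜ j + (N - + 1) * r j - N * 1ᶜ j ≡ (N - + 1) * r₀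
      collect j = trans (cong (λ x → 1ᶜ j + (N - + 1) * x - N * 1ᶜ j) (trans (r≡ j) (cong (_+_ r₀) (sym (ζ^≡δ 0F j)))))
                        (ring (1ᶜ j) N r₀)
        where ring : ∀ o N r₀ → o + (N - + 1) * (r₀ + o) - N * o ≡ (N - + 1) * r₀
              ring = solve-∀

  Walsh-norm : ∀ a → Walsh f a *ᶜ conj (Walsh f a) ≃ (N * N) · 1ᶜ
  Walsh-norm a with a ≟ᵥ 0ᵥ
  ... | yes refl = ≃-trans (*ᶜ-cong Walsh-at-0 (conj-cong {Walsh f 0ᵥ} {N · 1ᶜ} Walsh-at-0)) (·1ᶜ-norm N)
  ... | no a≢0 with fibre-constant a a≢0
  ...   | t , fibre≡t = ≃-trans (*ᶜ-cong Walsh≃Σζ^*ᶜY′ (conj-cong {Walsh f a} {Σζ^*ᶜ (Y r₀ r r≡)} Walsh≃Σζ^*ᶜY′))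
                                (Σζ^*ᶜ-norm (Y r₀ r r≡) N (Y-real r₀ r r≡) (Y-idem r₀ r r≡ N p*r₀≡N fibre≡t 𝟙D⋆𝟙D≡) (Y-sum r₀ r r≡ N p*r₀≡N fibre≡t))
    where
      open WalshViaLevelSets p f f-even f0 a
      Walsh≃Σζ^*ᶜY′ : Walsh f a ≃ Σζ^*ᶜ (Y r₀ r r≡)
      Walsh≃Σζ^*ᶜY′ = Walsh≃Σζ^*ᶜY r₀ r r≡

module LatinSquareType (p : ℕ) .{{_ : NonZero p}} (p-prime : Prime p) (m′ : ℕ) (s : ℤ) (s*s≡1 : s * s ≡ + 1) where
  open GF p hiding (Σℤ)
  open ModularArithmetic p
  open Enumerations p
  open Cyclotomic p

  -- The paper indexes the level sets by 1, …, p, with p standing for the value 0.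
  index : F → ℕ
  index c with c FinP.≟ 0F
  ... | yes _ = p
  ... | no _  = toℕ c

  index-mod : ∀ c → index c mod p ≡ c
  index-mod c with c FinP.≟ 0F
  ... | yes refl = ⟦⟧-injective (≡ₚ-trans (⟦mod⟧ p) (≡ₚ-trans p≡ₚ0 (≡ₚ-sym ⟦0F⟧)))
  ... | no _     = ⟦⟧-injective (⟦mod⟧ (toℕ c))

  index-positive : ∀ c → 1 ℕ.≤ index c
  index-positive c with c FinP.≟ 0F
  ... | yes _   = ℕ.>-nonZero⁻¹ p
  ... | no c≢0  = ℕP.n≢0⇒n>0 (toℕ≢0 c≢0)

  index≤p : ∀ c → index c ℕ.≤ p
  index≤p c with c FinP.≟ 0F
  ... | yes _ = ℕP.≤-refl
  ... | no _  = ℕP.<⇒≤ (FinP.toℕ<n c)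

  N : ℤ
  N = s * + (p ^ suc m′)

  r₀ : ℤ
  r₀ = s * + (p ^ m′)

  r : F → ℤ
  r c = LS.r s (suc m′) (index c)

  r≡ : ∀ c → r c ≡ r₀ + δF c 0F
  r≡ c with c FinP.≟ 0F
  ... | yes refl rewrite trans (isYes≗does (p ℕ.≟ p)) (dec-true (p ℕ.≟ p) refl) = refl
  ... | no _ rewrite trans (isYes≗does (toℕ c ℕ.≟ p)) (dec-false (toℕ c ℕ.≟ p) (ℕP.<⇒≢ (FinP.toℕ<n c))) =
    sym (ℤP.+-identityʳ r₀)

  p*r₀≡N : + p * r₀ ≡ N
  p*r₀≡N = trans (swap (+ p) s (+ (p ^ m′))) (cong (s *_) (sym (ℤP.pos-* p (p ^ m′))))
    where swap : ∀ P s Q → P * (s * Q) ≡ s * (P * Q)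
          swap = solve-∀

  N*N≡p^2m : N * N ≡ + (p ^ suc m′ ℕ.* p ^ suc m′)
  N*N≡p^2m = begin
    (s * P) * (s * P)   ≡⟨ regroup s P ⟩
    (s * s) * (P * P)   ≡⟨ cong (_* (P * P)) s*s≡1 ⟩
    + 1 * (P * P)       ≡⟨ ℤP.*-identityˡ (P * P) ⟩
    P * P               ≡⟨ sym (ℤP.pos-* (p ^ suc m′) (p ^ suc m′)) ⟩
    + (p ^ suc m′ ℕ.* p ^ suc m′) ∎
    where
      open ≡-Reasoning
      P = + (p ^ suc m′)
      regroup : ∀ s P → (s * P) * (s * P) ≡ (s * s) * (P * P)
      regroup = solve-∀

  bent : (f : V (2 ℕ.* suc m′) → F) → Even f → f 0ᵥ ≡ 0F → AllOfLSType s (suc m′) f → Bent (suc m′) f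
  bent f f-even f0 LS-type x = ≃⇒≈ᶜ (≃-trans (Walsh-norm x) (≗⇒≃ N*N·1ᶜ≗const))
    where
      open WalshNormFromSRG p p-prime f f-even f0 N r₀ r r≡ p*r₀≡N index index-mod
                            (λ c → LS-type (index c) (index-positive c) (index≤p c))
      N*N·1ᶜ≗const : (N * N) · 1ᶜ ≗ constᶜ (+ (p ^ suc m′ ℕ.* p ^ suc m′))
      N*N·1ᶜ≗const j = trans (cong (_* 1ᶜ j) N*N≡p^2m) (sym (constᶜ≗·1ᶜ _ j))

-- The argument does not use p > 2.
theorem6p1 : (p : ℕ) .{{_ : NonZero p}} → Prime p → 2 ℕ.< p →
    (m : ℕ) → 1 ℕ.≤ m →
    (f : Vec (Fin p) (2 ℕ.* m) → Fin p) →
    GF.Even p f → f (GF.0ᵥ p) ≡ GF.0F p →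
    (GF.AllOfLSType p (+ 1) m f ⊎ GF.AllOfLSType p (- (+ 1)) m f) →
    GF.Bent p m f
theorem6p1 p p-prime _ (suc m′) _ f f-even f0 (inj₁ LS-type)  = LatinSquareType.bent p p-prime m′ (+ 1) refl f f-even f0 LS-type
theorem6p1 p p-prime _ (suc m′) _ f f-even f0 (inj₂ NLS-type) = LatinSquareType.bent p p-prime m′ (- + 1) refl f f-even f0 NLS-type
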